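{- Let $\mathbb F$ be a finite field with $|\mathbb F| = p^r$ for a prime $p$ and $r\in\mathbb N$. Then for every integer $k\ge2$, with $\mathcal X = \mathbb F^{k+r}$ (viewed as the product of $k+r$ copies of $\mathbb F$, one per player), there exists a linear subspace $Q\subseteq\mathcal X$ of dimension $k$ such that for every $n\in\mathbb N$, $E_Q(n) = r_{grid}(\mathbb F,k,n)$.
   Context: For $Q\subseteq\mathcal X = \mathcal X^{(1)}\times\dots\times\mathcal X^{(m)}$ with $q=|Q|$ and $n\in\mathbb N$: for $x\in Q^n\subseteq \mathcal X^n$ write $x_i\in\mathcal X$ for its $i$-th coordinate tuple, $x^{(j)}\in(\mathcal X^{(j)})^n$ for the vector of $j$-th entries, and $x^{(j)}_i$ for the $j$-th entry of $x_i$. A set $W\subseteq Q^n$ contains a forbidden subgraph if there are $e(1),\dots,e(q)\in W$ and $i\in[n]$ such that (1) $\{e(1)_i,\dots,e(q)_i\}=Q$ and (2) for every $j\in[m]$ and $r,r'\in[q]$, $e(r)^{(j)}_i=e(r')^{(j)}_i$ implies $e(r)^{(j)}=e(r')^{(j)}$. $E_Q(n)$ is the maximum of $|W|/q^n$ over all $W\subseteq Q^n$ containing no forbidden subgraph. A grid in $(\mathbb F^n)^k$ is a set $\{x+\alpha\otimes d : \alpha\in\mathbb F^k\}$ with $x\in(\mathbb F^n)^k$, $d\in\mathbb F^n$, $d\ne 0$, where $\alpha\otimes d = (\alpha^{(1)}d,\dots,\alpha^{(k)}d)\in(\mathbb F^n)^k$. $r_{grid}(\mathbb F,k,n)$ is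 the maximum of $|A|/|\mathbb F|^{kn}$ over sets $A\subseteq(\mathbb F^n)^k$ containing no grid. -}

module Defs where

open import Level using (0ℓ; suc)
open import Algebra.Bundles using (CommutativeRing)
open import Data.Nat as ℕ using (ℕ; _≤_; _^_)
open import Data.Integer using (+_)
open import Data.Rational as ℚ using (ℚ)
open import Data.Fin using (Fin)
open import Data.Vec using (Vec; []; _∷_; lookup; map; zipWith; replicate)
open import Data.List using (List; length)
open import Data.List.Membership.Propositional using (_∈_)
open import Data.List.Relation.Unary.Unique.Propositional using (Unique)
open import Data.Product using (Σ; ∃; ∃-syntax; _×_; _,_)
open import Function.Bundles using (_↔_; _⇔_)
open import Relation.Nullary using (¬_)
open import Relation.Binary.PropositionalEquality using (_≡_)

record FiniteField : Set₁ where
  field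
    cring : CommutativeRing 0ℓ 0ℓ
  open CommutativeRing cring public
  field
    ≈⇒≡     : ∀ {x y} → x ≈ y → x ≡ y
    0≉1     : ¬ (0# ≈ 1#)
    inverse : ∀ x → ¬ (x ≈ 0#) → ∃[ y ] (x * y ≈ 1#)
    size    : ℕ
    enum    : Carrier ↔ Fin size

module _ (F : FiniteField) where
  open FiniteField F

  Vecᶠ : ℕ → Set
  Vecᶠ m = Vec Carrier m

  zeroV : ∀ {m} → Vecᶠ m
  zeroV = replicate _ 0#

  _+ᵛ_ : ∀ {m} → Vecᶠ m → Vecᶠ m → Vecᶠ m
  _+ᵛ_ = zipWith _+_

  _·ᵛ_ : ∀ {m} → Carrier → Vecᶠ m → Vecᶠ m
  c ·ᵛ v = map (c *_) v

  lincomb : ∀ {k m} → Vecᶠ k → Vec (Vecᶠ m) k → Vecᶠ m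
  lincomb []      []      = zeroV
  lincomb (a ∷ α) (b ∷ bs) = (a ·ᵛ b) +ᵛ lincomb α bs

  LinIndep : ∀ {k m} → Vec (Vecᶠ m) k → Set
  LinIndep b = ∀ α → lincomb α b ≡ zeroV → α ≡ zeroV

  IsSubspaceOfDim : (m k : ℕ) → (Vecᶠ m → Set) → Set
  IsSubspaceOfDim m k Q =
    ∃[ b ] (LinIndep {k} {m} b × (∀ x → Q x ⇔ (∃[ α ] (x ≡ lincomb α b))))

Card : {T : Set} → (T → Set) → ℕ → Set
Card {T} P c = ∃[ L ] (Unique L × (∀ x → x ∈ L ⇔ P x) × length L ≡ c)

MaxSize : {T : Set} → (List T → Set) → ℕ → Set
MaxSize {T} Good M =
  (∃[ W ] (Unique W × Good W × length W ≡ M)) ×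
  (∀ (W : List T) → Unique W → Good W → length W ≤ M)

module _ (F : FiniteField) where
  open FiniteField F

  -- X = F^m; elements of X^n are Vec (Vec F m) n
  -- x_i = lookup x i,   x^(j) = column j x,   x^(j)_i = lookup (lookup x i) j
  column : ∀ {m n} → Fin m → Vec (Vecᶠ F m) n → Vecᶠ F n
  column j x = map (λ v → lookup v j) x

  InPow : ∀ {m} → (Vecᶠ F m → Set) → (n : ℕ) → Vec (Vecᶠ F m) n → Set
  InPow Q n x = ∀ i → Q (lookup x i)

  ContainsForbidden : ∀ {m} → (Vecᶠ F m → Set) → ℕ → (n : ℕ) →
                      List (Vec (Vecᶠ F m) n) → Set
  ContainsForbidden {m} Q q n W =
    Σ (Fin q → Vec (Vecᶠ F m) n) λ e → Σ (Fin n) λ i →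
      ((∀ (t : Fin q) → e t ∈ W) ×
       (∀ y → Q y ⇔ (∃[ t ] (lookup (e t) i ≡ y))) ×
       (∀ (j : Fin m) (t t' : Fin q) →
          lookup (lookup (e t) i) j ≡ lookup (lookup (e t') i) j →
          column j (e t) ≡ column j (e t')))

  IsE : ∀ {m} → (Vecᶠ F m → Set) → ℕ → ℚ → Set
  IsE {m} Q n x =
    ∃[ q ] ∃[ M ]
      (Card Q q ×
       MaxSize (λ W → Data.List.Relation.Unary.All.All (InPow Q n) W ×
                      ¬ ContainsForbidden Q q n W) M ×
       x ℚ.* (+ (q ^ n) ℚ./ 1) ≡ + M ℚ./ 1)
    where import Data.List.Relation.Unary.All

  _⊗_ : ∀ {k n} → Vecᶠ F k → Vecᶠ F n → Vec (Vecᶠ F n) k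
  α ⊗ d = map (λ a → _·ᵛ_ F a d) α

  _+ᵍ_ : ∀ {k n} → Vec (Vecᶠ F n) k → Vec (Vecᶠ F n) k → Vec (Vecᶠ F n) k
  _+ᵍ_ = zipWith (_+ᵛ_ F)

  ContainsGrid : (k n : ℕ) → List (Vec (Vecᶠ F n) k) → Set
  ContainsGrid k n A =
    Σ (Vec (Vecᶠ F n) k) λ x → Σ (Vecᶠ F n) λ d → (¬ (d ≡ zeroV F) × (∀ (α : Vecᶠ F k) → (x +ᵍ (α ⊗ d)) ∈ A))

  IsRgrid : ℕ → ℕ → ℚ → Set
  IsRgrid k n x =
    ∃[ M ] (MaxSize (λ A → ¬ ContainsGrid k n A) M ×
            x ℚ.* (+ (size ^ (k ℕ.* n)) ℚ./ 1) ≡ + M ℚ./ 1)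

{-# OPTIONS --safe #-}
module Submission where

-- Choose b₁, …, b_r ∈ F spanning F over its prime field, with 1 among them (there are exactly r
-- because |F| = p ^ r), and let Q ⊆ F^(k+r) be the image of the linear embedding
--   α ↦ (α₀, …, α_{k-1}, (α₀ + b_l (α₁ + ⋯ + α_{k-1}))_l).
-- Transposition identifies (F^n)^k with Q^n.  A grid {x + α ⊗ d} becomes a forbidden subgraph at
-- any coordinate i with d_i ≠ 0.  Conversely, a forbidden subgraph at coordinate i picks for each
-- α ∈ F^k a member g α of A whose i-th column is α, and for every coordinate i′ the map
-- h α = (i′-th column of g α) preserves the fibres of each of the k + r coordinate functionals of Q.
-- Such an h is affine, h α = h 0 + δ α: the coordinate projections force h − h 0 to act
-- coordinatewise by maps ψ_j; the functional for b = 1 shows that all ψ_j are one additive map A,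
-- and the other functionals give A (b x) = b A x, so A is F-linear because the b_l span F.  So the
-- g α form a grid, nondegenerate because h is the identity for i′ = i.  Hence grid-free sets and
-- sets without forbidden subgraph correspond bijectively, and the two normalised maxima agree.

open import Level using (0ℓ)
open import Data.Bool using (true; false)
open import Data.Fin as Fin using (Fin; toℕ; _↑ˡ_; _↑ʳ_)
import Data.Fin.Properties as Fin
import Data.Integer as ℤ
import Data.Integer.Properties as ℤ
open import Data.List as List using (List; []; _∷_; _++_; [_]; length; map; filter; cartesianProductWith)
open import Data.List.Extrema.Nat using (argmax; f[xs]≤f[argmax]; argmax-all)
open import Data.List.Membership.Propositional using (_∈_; lose)
open import Data.List.Membership.Propositional.Properties
  using (∈-∃++; ∈-allFin; ∈-map⁺; ∈-map⁻; ∈-++⁺ˡ; ∈-++⁺ʳ; ∈-++⁻; ∈-cartesianProductWith⁺;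
         ∈-filter⁺; ∈-filter⁻)
open import Data.List.Properties using (length-++; length-map; length-tabulate)
open import Data.List.Relation.Binary.Permutation.Propositional.Properties using (shift; ∈-resp-↭; ↭-length)
open import Data.List.Relation.Binary.Sublist.Propositional using ([]; _∷_; _∷ʳ_) renaming (_⊆_ to _⊑_)
open import Data.List.Relation.Binary.Sublist.Propositional.Properties using (All-resp-⊆)
open import Data.List.Relation.Binary.Subset.Propositional using (_⊆_)
open import Data.List.Relation.Unary.All as All using (All; []; _∷_)
import Data.List.Relation.Unary.All.Properties as All
open import Data.List.Relation.Unary.Any as Any using (Any; here; there)
open import Data.List.Relation.Unary.Any.Properties using (lookup-index)
open import Data.List.Relation.Unary.Unique.Propositional using (Unique; []; _∷_)
import Data.List.Relation.Unary.Unique.Propositional.Properties as Unique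
open import Data.Nat as ℕ using (ℕ; zero; suc; _<_; _≤_; _^_; z≤n; s≤s; NonZero; nonTrivial⇒n>1)
import Data.Nat.Properties as ℕ
open import Data.Nat.Coprimality using (coprime-Bézout; prime⇒coprime)
open import Data.Nat.Divisibility using (_∣_; ∣1⇒≡1; m∣m*n)
open import Data.Nat.DivMod using (_%_; _/_; m≡m%n+[m/n]*n; m%n<n)
open import Data.Nat.GCD using (module Bézout)
open import Data.Nat.ListAction using (product)
open import Data.Nat.Primality
  using (Prime; prime⇒nonZero; prime⇒nonTrivial; prime⇒irreducible; euclidsLemma; ¬prime[1])
open import Data.Nat.Primality.Factorisation using (factorise; PrimeFactorisation)
open import Data.Product using (∃; ∃-syntax; _×_; _,_; proj₁; proj₂)
open import Data.Rational as ℚ using (ℚ)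
import Data.Rational.Properties as ℚ
import Data.Rational.Unnormalised as ℚᵘ
import Data.Rational.Unnormalised.Properties as ℚᵘ
open import Data.Sum using (_⊎_; inj₁; inj₂; [_,_]′)
open import Data.Vec as Vec using (Vec; []; _∷_; lookup; tabulate; _[_]≔_)
open import Data.Vec.Membership.Propositional using () renaming (_∈_ to _∈ᵥ_)
open import Data.Vec.Properties
  using (∷-injective; ≡-dec; lookup-zipWith; lookup-map; lookup-replicate; lookup∘tabulate;
         tabulate∘lookup; tabulate-cong; lookup∘update; lookup∘update′; map-replicate)
open import Data.Vec.Relation.Unary.Any as Anyᵥ using (here; there)
open import Data.Vec.Relation.Unary.Any.Properties using () renaming (lookup-index to lookup-indexᵥ)
open import Function using (_∘_; id; case_of_; _↔_; _⇔_; mk⇔; Inverse; Injection; Equivalence)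
open import Function.Properties.Inverse using (↔⇒↣; ↔-sym)
open import Relation.Binary.Definitions using (DecidableEquality; tri<; tri≈; tri>)
open import Relation.Binary.PropositionalEquality as ≡ using (_≡_; _≢_; cong; cong₂)
open import Relation.Nullary using (¬_; Dec; yes; no; does; contradiction)
open import Relation.Nullary.Decidable using (map′; ¬?; decidable-stable; _×-dec_)
open import Relation.Unary using (Pred; Decidable)

open import Defs

-- Finite enumerations and largest good sets

record Enumeration (A : Set) : Set where
  field
    elements : List A
    unique   : Unique elements
    complete : ∀ x → x ∈ elements

open Enumeration

module _ {A : Set} where

  Unique-resp-⊑ : ∀ {xs ys : List A} → xs ⊑ ys → Unique ys → Unique xs
  Unique-resp-⊑ []             []           = []
  Unique-resp-⊑ (y ∷ʳ xs⊑ys)    (_ ∷ ys!)    = Unique-resp-⊑ xs⊑ys ys!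
  Unique-resp-⊑ (≡.refl ∷ xs⊑ys) (y∉ys ∷ ys!) = All-resp-⊆ xs⊑ys y∉ys ∷ Unique-resp-⊑ xs⊑ys ys!

  Unique-⊆⇒length≤ : ∀ {xs ys : List A} → Unique xs → xs ⊆ ys → length xs ≤ length ys
  Unique-⊆⇒length≤ []           _     = z≤n
  Unique-⊆⇒length≤ {x ∷ xs} (x∉xs ∷ xs!) xs⊆ys
    with ys₁ , ys₂ , ≡.refl ← ∈-∃++ (xs⊆ys (here ≡.refl)) =
    ≡.subst (suc (length xs) ≤_) (≡.sym (↭-length (shift x ys₁ ys₂)))
      (s≤s (Unique-⊆⇒length≤ xs! xs⊆ys₁ys₂))
    where
    xs⊆ys₁ys₂ : xs ⊆ ys₁ ++ ys₂
    xs⊆ys₁ys₂ {z} z∈xs with ∈-resp-↭ (shift x ys₁ ys₂) (xs⊆ys (there z∈xs))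
    ... | here z≡x   = contradiction z≡x (All.lookup x∉xs z∈xs ∘ ≡.sym)
    ... | there z∈ys = z∈ys

  length-cartesianProductWith : ∀ {B C : Set} (f : A → B → C) xs ys →
    length (cartesianProductWith f xs ys) ≡ length xs ℕ.* length ys
  length-cartesianProductWith f []       ys = ≡.refl
  length-cartesianProductWith f (x ∷ xs) ys = begin
    length (map (f x) ys ++ cartesianProductWith f xs ys)  ≡⟨ length-++ (map (f x) ys) ⟩
    length (map (f x) ys) ℕ.+ length (cartesianProductWith f xs ys)
      ≡⟨ cong₂ ℕ._+_ (length-map (f x) ys) (length-cartesianProductWith f xs ys) ⟩
    length ys ℕ.+ length xs ℕ.* length ys  ∎
    where open ≡.≡-Reasoning

  vectors : List A → (n : ℕ) → List (Vec A n)
  vectors xs zero    = [ [] ]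
  vectors xs (suc n) = cartesianProductWith _∷_ xs (vectors xs n)

  length-vectors : ∀ xs n → length (vectors xs n) ≡ length xs ^ n
  length-vectors xs zero    = ≡.refl
  length-vectors xs (suc n) =
    ≡.trans (length-cartesianProductWith _∷_ xs (vectors xs n)) (cong (length xs ℕ.*_) (length-vectors xs n))

  ∈-vectors : ∀ {xs} → (∀ x → x ∈ xs) → ∀ {n} (v : Vec A n) → v ∈ vectors xs n
  ∈-vectors xs-complete []      = here ≡.refl
  ∈-vectors xs-complete (x ∷ v) = ∈-cartesianProductWith⁺ _∷_ (xs-complete x) (∈-vectors xs-complete v)

  vectors-unique : ∀ {xs} → Unique xs → ∀ n → Unique (vectors xs n)
  vectors-unique xs! zero    = [] ∷ []
  vectors-unique xs! (suc n) = Unique.cartesianProductWith⁺ _∷_ ∷-injective xs! (vectors-unique xs! n)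

  sublists : List A → List (List A)
  sublists []       = [ [] ]
  sublists (x ∷ xs) = map (x ∷_) (sublists xs) ++ sublists xs

  ∈-sublists⇒⊑ : ∀ {xs ys} → ys ∈ sublists xs → ys ⊑ xs
  ∈-sublists⇒⊑ {[]}     (here ≡.refl) = []
  ∈-sublists⇒⊑ {x ∷ xs} ys∈ with ∈-++⁻ (map (x ∷_) (sublists xs)) ys∈
  ... | inj₁ ys∈map with _ , zs∈ , ≡.refl ← ∈-map⁻ (x ∷_) ys∈map = ≡.refl ∷ ∈-sublists⇒⊑ zs∈
  ... | inj₂ ys∈rest = x ∷ʳ ∈-sublists⇒⊑ ys∈rest

  filter∈sublists : ∀ {P : Pred A 0ℓ} (P? : Decidable P) xs → filter P? xs ∈ sublists xs
  filter∈sublists P? []       = here ≡.refl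
  filter∈sublists P? (x ∷ xs) with does (P? x)
  ... | true  = ∈-++⁺ˡ (∈-map⁺ (x ∷_) (filter∈sublists P? xs))
  ... | false = ∈-++⁺ʳ (map (x ∷_) (sublists xs)) (filter∈sublists P? xs)

vecEnumeration : ∀ {A} → Enumeration A → (n : ℕ) → Enumeration (Vec A n)
vecEnumeration E n = record
  { elements = vectors (elements E) n
  ; unique   = vectors-unique (unique E) n
  ; complete = ∈-vectors (complete E)
  }

module _ {A : Set} (E : Enumeration A) {P : Pred A 0ℓ} (P? : Decidable P) where

  ∃? : Dec (∃ P)
  ∃? = map′ Any.satisfied (λ (x , px) → lose (complete E x) px) (Any.any? P? (elements E))

  ∀? : Dec (∀ x → P x)
  ∀? = map′ (λ all x → All.lookup all (complete E x)) (λ h → All.tabulate (λ {x} _ → h x))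
             (All.all? P? (elements E))

module _ {T : Set} (_≟_ : DecidableEquality T) (E : Enumeration T)
         {Good : List T → Set} (good? : ∀ W → Dec (Good W)) (good[] : Good [])
         (good-resp : ∀ {W W′} → W ⊆ W′ → W′ ⊆ W → Good W → Good W′) where

  open import Data.List.Membership.DecPropositional _≟_ using (_∈?_)

  private
    candidates : List (List T)
    candidates = filter good? (sublists (elements E))

    largest : List T
    largest = argmax length [] candidates

  maxSize-exists : ∃ (MaxSize Good)
  maxSize-exists = length largest , (largest , proj₁ largest-unique-good , proj₂ largest-unique-good , ≡.refl) , largest-max
    where
    largest-unique-good : Unique largest × Good largest
    largest-unique-good = argmax-all length ([] , good[]) (All.tabulate λ W∈ →
      let W∈sublists , good = ∈-filter⁻ good? W∈
      in Unique-resp-⊑ (∈-sublists⇒⊑ W∈sublists) (unique E) , good)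

    -- W has the same elements as the sublist S of the enumeration that it selects, so S is a candidate.
    largest-max : ∀ W → Unique W → Good W → length W ≤ length largest
    largest-max W W! goodW =
      ℕ.≤-trans (Unique-⊆⇒length≤ W! W⊆S) (All.lookup (f[xs]≤f[argmax] {f = length} [] candidates) S∈)
      where
      S = filter (_∈? W) (elements E)
      W⊆S : W ⊆ S
      W⊆S {x} x∈W = ∈-filter⁺ (_∈? W) (complete E x) x∈W
      S∈ : S ∈ candidates
      S∈ = ∈-filter⁺ good? (filter∈sublists (_∈? W) (elements E))
             (good-resp W⊆S (proj₂ ∘ ∈-filter⁻ (_∈? W) {xs = elements E}) goodW)

allFinEnumeration : ∀ n → Enumeration (Fin n)
allFinEnumeration n = record
  { elements = List.allFin n
  ; unique   = Unique.allFin⁺ n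
  ; complete = ∈-allFin
  }

length-allFinEnumeration : ∀ n → length (elements (allFinEnumeration n)) ≡ n
length-allFinEnumeration n = length-tabulate id

↔⇒Enumeration : ∀ {A n} → A ↔ Fin n → Enumeration A
↔⇒Enumeration {n = n} A↔Fin = record
  { elements = map from (List.allFin n)
  ; unique   = Unique.map⁺ (Injection.injective (↔⇒↣ (↔-sym A↔Fin))) (Unique.allFin⁺ n)
  ; complete = λ x → ≡.subst (_∈ map from (List.allFin n)) (strictlyInverseʳ x) (∈-map⁺ from (∈-allFin (to x)))
  }
  where open Inverse A↔Fin

length-↔⇒Enumeration : ∀ {A n} (A↔Fin : A ↔ Fin n) → length (elements (↔⇒Enumeration A↔Fin)) ≡ n
length-↔⇒Enumeration {n = n} A↔Fin = ≡.trans (length-map _ (List.allFin n)) (length-allFinEnumeration n)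

Card-image : ∀ {A B : Set} (E : Enumeration A) (f : A → B) → (∀ {x y} → f x ≡ f y → x ≡ y) →
             Card (λ y → ∃ λ x → y ≡ f x) (length (elements E))
Card-image E f f-inj = map f (elements E) , Unique.map⁺ f-inj (unique E) , ∈⇔image , length-map f (elements E)
  where
  ∈⇔image : ∀ y → y ∈ map f (elements E) ⇔ ∃ λ x → y ≡ f x
  ∈⇔image y = mk⇔ (λ y∈ → let x , _ , y≡fx = ∈-map⁻ f y∈ in x , y≡fx)
                  (λ (x , y≡fx) → ≡.subst (_∈ map f (elements E)) (≡.sym y≡fx) (∈-map⁺ f (complete E x)))

MaxSize-map : ∀ {S T : Set} {GoodS : List S → Set} {GoodT : List T → Set} {M} (f : S → T) →
              (∀ {x y} → f x ≡ f y → x ≡ y) →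
              (∀ {V} → GoodS V → GoodT (map f V)) →
              (∀ {W} → GoodT W → ∃ λ V → W ≡ map f V × GoodS V) →
              MaxSize GoodS M → MaxSize GoodT M
MaxSize-map {GoodT = GoodT} {M = M} f f-inj good⁺ good⁻ ((V , V! , goodV , |V|≡M) , V-max) =
  (map f V , Unique.map⁺ f-inj V! , good⁺ goodV , ≡.trans (length-map f V) |V|≡M) , W-max
  where
  W-max : ∀ W → Unique W → GoodT W → length W ≤ M
  W-max W W! goodW with V′ , ≡.refl , goodV′ ← good⁻ goodW =
    ≡.subst (_≤ M) (≡.sym (length-map f V′)) (V-max V′ (Unique.map⁻ W!) goodV′)

-- Arithmetic

n<m^n : ∀ {m} → 1 < m → ∀ n → n < m ^ n
n<m^n 1<m zero    = s≤s z≤n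
n<m^n 1<m (suc n) = ℕ.≤-<-trans (n<m^n 1<m n) (ℕ.^-monoʳ-< _ 1<m (ℕ.n<1+n n))

^-injectiveʳ : ∀ {p} → 1 < p → ∀ {m n} → p ^ m ≡ p ^ n → m ≡ n
^-injectiveʳ {p} 1<p {m} {n} p^m≡p^n with ℕ.<-cmp m n
... | tri< m<n _ _ = contradiction p^m≡p^n (ℕ.<⇒≢ (ℕ.^-monoʳ-< p 1<p m<n))
... | tri≈ _ m≡n _ = m≡n
... | tri> _ _ n<m = contradiction (≡.sym p^m≡p^n) (ℕ.<⇒≢ (ℕ.^-monoʳ-< p 1<p n<m))

prime∣prime^n⇒≡ : ∀ {c p} → Prime c → Prime p → ∀ n → c ∣ p ^ n → c ≡ p
prime∣prime^n⇒≡ c-prime p-prime zero    c∣1 = contradiction (≡.subst Prime (∣1⇒≡1 c∣1) c-prime) ¬prime[1]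
prime∣prime^n⇒≡ {p = p} c-prime p-prime (suc n) c∣p^1+n with euclidsLemma p (p ^ n) c-prime c∣p^1+n
... | inj₂ c∣p^n = prime∣prime^n⇒≡ c-prime p-prime n c∣p^n
... | inj₁ c∣p with prime⇒irreducible p-prime c∣p
...   | inj₁ c≡1 = contradiction (≡.subst Prime c≡1 c-prime) ¬prime[1]
...   | inj₂ c≡p = c≡p

prime-powers-injective : ∀ {c p s r} → Prime c → Prime p → c ^ suc s ≡ p ^ r → suc s ≡ r
prime-powers-injective {c} {p} {s} {r} c-prime p-prime c^1+s≡p^r =
  ^-injectiveʳ (nonTrivial⇒n>1 p {{prime⇒nonTrivial p-prime}}) (≡.subst (λ b → b ^ suc s ≡ p ^ r) c≡p c^1+s≡p^r)
  where
  c≡p : c ≡ p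
  c≡p = prime∣prime^n⇒≡ c-prime p-prime r (≡.subst (c ∣_) c^1+s≡p^r (m∣m*n (c ^ s)))

/-*-cancel : ∀ m n .{{_ : NonZero n}} → (ℤ.+ m ℚ./ n) ℚ.* (ℤ.+ n ℚ./ 1) ≡ ℤ.+ m ℚ./ 1
/-*-cancel m (suc n) = ℚ.toℚᵘ-injective (begin
  ℚ.toℚᵘ ((ℤ.+ m ℚ./ suc n) ℚ.* (ℤ.+ suc n ℚ./ 1))
    ≈⟨ ℚ.toℚᵘ-homo-* (ℤ.+ m ℚ./ suc n) (ℤ.+ suc n ℚ./ 1) ⟩
  ℚ.toℚᵘ (ℤ.+ m ℚ./ suc n) ℚᵘ.* ℚ.toℚᵘ (ℤ.+ suc n ℚ./ 1)
    ≈⟨ ℚᵘ.*-cong (ℚ.toℚᵘ-fromℚᵘ m/1+n) (ℚ.toℚᵘ-fromℚᵘ 1+n/1) ⟩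
  m/1+n ℚᵘ.* 1+n/1
    ≈⟨ ℚᵘ.*≡* cross-multiplied ⟩
  m/1
    ≈⟨ ℚ.toℚᵘ-fromℚᵘ m/1 ⟨
  ℚ.toℚᵘ (ℤ.+ m ℚ./ 1)  ∎)
  where
  open import Relation.Binary.Reasoning.Setoid ℚᵘ.≃-setoid
  m/1+n = ℚᵘ.mkℚᵘ (ℤ.+ m) n
  1+n/1 = ℚᵘ.mkℚᵘ (ℤ.+ suc n) 0
  m/1   = ℚᵘ.mkℚᵘ (ℤ.+ m) 0
  cross-multiplied : (ℤ.+ m ℤ.* ℤ.+ suc n) ℤ.* ℤ.+ 1 ≡ ℤ.+ m ℤ.* ℤ.+ (suc n ℕ.* 1)
  cross-multiplied = ≡.trans (ℤ.*-identityʳ _) (cong (λ k → ℤ.+ m ℤ.* ℤ.+ k) (≡.sym (ℕ.*-identityʳ (suc n))))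


module _ (F : FiniteField) where

  open FiniteField F
  open import Algebra.Properties.Ring ring
    using (+-identityʳ-unique; +-inverseʳ-unique; +-cancelˡ; x+x≈x⇒x≈0; -1*x≈-x; xyx⁻¹≈y)
  open import Algebra.Properties.Semiring.Mult semiring
    using (×-homo-+; ×1-homo-*; ×-assoc-*; ×-assocˡ; ×-congʳ) renaming (_×_ to _·_)
  open import Relation.Binary.Reasoning.Setoid setoid

  _≟_ : DecidableEquality Carrier
  x ≟ y = map′ (Injection.injective (↔⇒↣ enum)) (cong (Inverse.to enum))
                (Inverse.to enum x Fin.≟ Inverse.to enum y)

  carriers : Enumeration Carrier
  carriers = ↔⇒Enumeration enum

  length-carriers : length (elements carriers) ≡ size
  length-carriers = length-↔⇒Enumeration enum

  0≢1 : 0# ≢ 1#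
  0≢1 = 0≉1 ∘ reflexive

  *-cancelˡ-≢0 : ∀ {x y z} → x ≢ 0# → x * y ≡ x * z → y ≡ z
  *-cancelˡ-≢0 {x} {y} {z} x≢0 xy≡xz = ≈⇒≡ (begin
    y              ≈⟨ *-identityˡ y ⟨
    1# * y         ≈⟨ *-congʳ x⁻¹x≈1 ⟨
    (x⁻¹ * x) * y  ≈⟨ *-assoc x⁻¹ x y ⟩
    x⁻¹ * (x * y)  ≡⟨ cong (x⁻¹ *_) xy≡xz ⟩
    x⁻¹ * (x * z)  ≈⟨ *-assoc x⁻¹ x z ⟨
    (x⁻¹ * x) * z  ≈⟨ *-congʳ x⁻¹x≈1 ⟩
    1# * z         ≈⟨ *-identityˡ z ⟩
    z              ∎)
    where
    x⁻¹ = proj₁ (inverse x (x≢0 ∘ ≈⇒≡))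
    x⁻¹x≈1 : x⁻¹ * x ≈ 1#
    x⁻¹x≈1 = trans (*-comm x⁻¹ x) (proj₂ (inverse x (x≢0 ∘ ≈⇒≡)))

  x+[y-x]≈y : ∀ x y → x + (y + (- 1#) * x) ≈ y
  x+[y-x]≈y x y = begin
    x + (y + (- 1#) * x)  ≈⟨ +-congˡ (+-congˡ (-1*x≈-x x)) ⟩
    x + (y + - x)         ≈⟨ +-assoc x y (- x) ⟨
    (x + y) + - x         ≈⟨ xyx⁻¹≈y x y ⟩
    y                     ∎

  zero-product : ∀ x y → x * y ≡ 0# → x ≡ 0# ⊎ y ≡ 0#
  zero-product x y xy≡0 with x ≟ 0#
  ... | yes x≡0 = inj₁ x≡0
  ... | no  x≢0 = inj₂ (*-cancelˡ-≢0 x≢0 (≡.trans xy≡0 (≡.sym (≈⇒≡ (zeroʳ x)))))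

  -- The prime characteristic and a spanning family over the prime field

  positive-characteristic : ∃ λ m → NonZero m × m · 1# ≡ 0#
  positive-characteristic
    with i , j , i<j , same ← Fin.pigeonhole (ℕ.n<1+n size) (λ (i : Fin (suc size)) → Inverse.to enum (toℕ i · 1#)) =
    m , ℕ.>-nonZero (ℕ.m<n⇒0<n∸m i<j) , ≈⇒≡ (+-identityʳ-unique (toℕ i · 1#) (m · 1#) (begin
      toℕ i · 1# + m · 1#  ≈⟨ ×-homo-+ 1# (toℕ i) m ⟨
      (toℕ i ℕ.+ m) · 1#   ≡⟨ cong (_· 1#) (ℕ.m+[n∸m]≡n (ℕ.<⇒≤ i<j)) ⟩
      toℕ j · 1#           ≡⟨ Injection.injective (↔⇒↣ enum) same ⟨
      toℕ i · 1#           ∎))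
    where m = toℕ j ℕ.∸ toℕ i

  product-·1≡0 : ∀ ms → product ms · 1# ≡ 0# → Any (λ m → m · 1# ≡ 0#) ms
  product-·1≡0 []       1≡0   = contradiction (≡.trans (≡.sym 1≡0) (≈⇒≡ (+-identityʳ 1#))) 0≢1
  product-·1≡0 (m ∷ ms) mms≡0
    with zero-product (m · 1#) (product ms · 1#) (≡.trans (≡.sym (≈⇒≡ (×1-homo-* m (product ms)))) mms≡0)
  ... | inj₁ m≡0  = here m≡0
  ... | inj₂ ms≡0 = there (product-·1≡0 ms ms≡0)

  prime-characteristic : ∃ λ c → Prime c × c · 1# ≡ 0#
  prime-characteristic with m , m≢0 , m·1≡0 ← positive-characteristic =
    Any.lookup vanishing , All.lookupAny factorsPrime vanishing
    where
    open PrimeFactorisation (factorise m {{m≢0}})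
    vanishing = product-·1≡0 factors (≡.subst (λ n → n · 1# ≡ 0#) isFactorisation m·1≡0)

  combination : ∀ {s} → Vec ℕ s → Vec Carrier s → Carrier
  combination []       []       = 0#
  combination (m ∷ ms) (b ∷ bs) = m · b + combination ms bs

  infix 4 _∈Span_
  _∈Span_ : ∀ {s} → Carrier → Vec Carrier s → Set
  x ∈Span bs = ∃ λ ms → combination ms bs ≡ x

  Spans : ∀ {s} → Vec Carrier s → Set
  Spans bs = ∀ x → x ∈Span bs

  combination-+ : ∀ {s} (ms ns : Vec ℕ s) bs →
                  combination (Vec.zipWith ℕ._+_ ms ns) bs ≈ combination ms bs + combination ns bs
  combination-+ []       []       []       = sym (+-identityˡ 0#)
  combination-+ (m ∷ ms) (n ∷ ns) (b ∷ bs) = begin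
    (m ℕ.+ n) · b + combination (Vec.zipWith ℕ._+_ ms ns) bs
      ≈⟨ +-cong (×-homo-+ b m n) (combination-+ ms ns bs) ⟩
    (m · b + n · b) + (combination ms bs + combination ns bs)
      ≈⟨ interchange (m · b) (n · b) _ _ ⟩
    (m · b + combination ms bs) + (n · b + combination ns bs)  ∎
    where open import Algebra.Properties.CommutativeSemigroup +-commutativeSemigroup using (interchange)

  combination-· : ∀ {s} m (ns : Vec ℕ s) bs → combination (Vec.map (m ℕ.*_) ns) bs ≈ m · combination ns bs
  combination-· m []       []       = sym (×-zeroʳ m)
    where
    ×-zeroʳ : ∀ m → m · 0# ≈ 0#
    ×-zeroʳ zero    = refl
    ×-zeroʳ (suc m) = trans (+-identityˡ (m · 0#)) (×-zeroʳ m)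
  combination-· m (n ∷ ns) (b ∷ bs) = begin
    (m ℕ.* n) · b + combination (Vec.map (m ℕ.*_) ns) bs  ≈⟨ +-cong (sym (×-assocˡ b m n)) (combination-· m ns bs) ⟩
    m · (n · b) + m · combination ns bs                    ≈⟨ ×-distrib-+ (n · b) _ m ⟨
    m · (n · b + combination ns bs)                        ∎
    where open import Algebra.Properties.CommutativeMonoid.Mult +-commutativeMonoid using (×-distrib-+)

  +-∈Span : ∀ {s} {bs : Vec Carrier s} {x y} → x ∈Span bs → y ∈Span bs → x + y ∈Span bs
  +-∈Span {bs = bs} (ms , ≡.refl) (ns , ≡.refl) = Vec.zipWith ℕ._+_ ms ns , ≈⇒≡ (combination-+ ms ns bs)

  ·-∈Span : ∀ {s} {bs : Vec Carrier s} m {x} → x ∈Span bs → m · x ∈Span bs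
  ·-∈Span {bs = bs} m (ns , ≡.refl) = Vec.map (m ℕ.*_) ns , ≈⇒≡ (combination-· m ns bs)

  module _ {A : Carrier → Carrier} (A-+-homo : ∀ x y → A (x + y) ≡ A x + A y) where

    0-homo-by-+-homo : A 0# ≡ 0#
    0-homo-by-+-homo = ≈⇒≡ (x+x≈x⇒x≈0 (A 0#) (begin
      A 0# + A 0#  ≡⟨ A-+-homo 0# 0# ⟨
      A (0# + 0#)  ≡⟨ cong A (≈⇒≡ (+-identityʳ 0#)) ⟩
      A 0#         ∎))

    ·-homo-by-+-homo : ∀ m x → A (m · x) ≡ m · A x
    ·-homo-by-+-homo zero    x = 0-homo-by-+-homo
    ·-homo-by-+-homo (suc m) x = ≡.trans (A-+-homo x (m · x)) (cong (A x +_) (·-homo-by-+-homo m x))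

    *-homo-by-spanning : ∀ {s} {bs : Vec Carrier s} → Spans bs →
                         (∀ i x → A (lookup bs i * x) ≡ lookup bs i * A x) →
                         ∀ c x → A (c * x) ≡ c * A x
    *-homo-by-spanning {bs = bs} spans bs-homo c x with ms , ≡.refl ← spans c = combination-homo ms bs bs-homo
      where
      combination-homo : ∀ {s} (ms : Vec ℕ s) bs → (∀ i x → A (lookup bs i * x) ≡ lookup bs i * A x) →
                         A (combination ms bs * x) ≡ combination ms bs * A x
      combination-homo []       []       _    = ≈⇒≡ (begin
        A (0# * x)  ≡⟨ cong A (≈⇒≡ (zeroˡ x)) ⟩
        A 0#        ≡⟨ 0-homo-by-+-homo ⟩
        0#          ≈⟨ zeroˡ (A x) ⟨
        0# * A x    ∎)
      combination-homo (m ∷ ms) (b ∷ bs) homo = ≈⇒≡ (begin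
        A ((m · b + C) * x)          ≡⟨ cong A (≈⇒≡ (distribʳ x (m · b) C)) ⟩
        A ((m · b) * x + C * x)      ≡⟨ A-+-homo ((m · b) * x) (C * x) ⟩
        A ((m · b) * x) + A (C * x)  ≡⟨ cong₂ _+_ (cong A (≈⇒≡ (×-assoc-* m b x)))
                                                   (combination-homo ms bs (homo ∘ Fin.suc)) ⟩
        A (m · (b * x)) + C * A x    ≡⟨ cong (_+ C * A x) (·-homo-by-+-homo m (b * x)) ⟩
        m · A (b * x) + C * A x      ≡⟨ cong (λ z → m · z + C * A x) (homo Fin.zero x) ⟩
        m · (b * A x) + C * A x      ≈⟨ +-congʳ (×-assoc-* m b (A x)) ⟨
        (m · b) * A x + C * A x      ≈⟨ distribʳ (A x) (m · b) C ⟨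
        (m · b + C) * A x            ∎)
        where C = combination ms bs

  module Characteristic {c} (c-prime : Prime c) (c·1≡0 : c · 1# ≡ 0#) where

    instance
      c≢0 : NonZero c
      c≢0 = prime⇒nonZero c-prime

    multiple-of-c·≡0 : ∀ q x → (q ℕ.* c) · x ≡ 0#
    multiple-of-c·≡0 q x = ≈⇒≡ (begin
      (q ℕ.* c) · x   ≡⟨ cong (_· x) (ℕ.*-comm q c) ⟩
      (c ℕ.* q) · x   ≈⟨ ×-assocˡ x c q ⟨
      c · (q · x)     ≈⟨ ×-congʳ c (*-identityˡ (q · x)) ⟨
      c · (1# * q · x)  ≈⟨ ×-assoc-* c 1# (q · x) ⟨
      (c · 1#) * q · x  ≡⟨ cong (_* q · x) c·1≡0 ⟩
      0# * q · x        ≈⟨ zeroˡ (q · x) ⟩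
      0#                ∎)

    ·≡·-mod : ∀ m x → m · x ≡ (m % c) · x
    ·≡·-mod m x = ≈⇒≡ (begin
      m · x                                ≡⟨ cong (_· x) (m≡m%n+[m/n]*n m c) ⟩
      (m % c ℕ.+ (m / c) ℕ.* c) · x        ≈⟨ ×-homo-+ x (m % c) ((m / c) ℕ.* c) ⟩
      (m % c) · x + ((m / c) ℕ.* c) · x    ≡⟨ cong ((m % c) · x +_) (multiple-of-c·≡0 (m / c) x) ⟩
      (m % c) · x + 0#                     ≈⟨ +-identityʳ _ ⟩
      (m % c) · x                          ∎)

    pred-c·≡- : ∀ x → ℕ.pred c · x ≡ - x
    pred-c·≡- x = ≈⇒≡ (+-inverseʳ-unique x (ℕ.pred c · x) (begin
      suc (ℕ.pred c) · x   ≡⟨ cong (_· x) (ℕ.suc-pred c) ⟩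
      c · x                ≡⟨ cong (_· x) (ℕ.*-identityˡ c) ⟨
      (1 ℕ.* c) · x        ≡⟨ multiple-of-c·≡0 1 x ⟩
      0#                   ∎))

    -‿∈Span : ∀ {s} {bs : Vec Carrier s} {x} → x ∈Span bs → - x ∈Span bs
    -‿∈Span {bs = bs} x∈ = ≡.subst (_∈Span bs) (pred-c·≡- _) (·-∈Span (ℕ.pred c) x∈)

    -- d is invertible modulo the prime c (Bézout), and multiples of c annihilate y.
    ·-cancel-∈Span : ∀ {s} {bs : Vec Carrier s} {d y} → 0 < d → d < c → d · y ∈Span bs → y ∈Span bs
    ·-cancel-∈Span {bs = bs} {d@(suc _)} {y} _ d<c dy∈ = cancel (coprime-Bézout (prime⇒coprime c-prime d<c))
      where
      zd·y∈ : ∀ z → (z ℕ.* d) · y ∈Span bs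
      zd·y∈ z = ≡.subst (_∈Span bs) (≈⇒≡ (×-assocˡ y z d)) (·-∈Span z dy∈)

      cancel : Bézout.Identity 1 c d → y ∈Span bs
      cancel (Bézout.-+ q z 1+qc≡zd) = ≡.subst (_∈Span bs) zd·y≡y (zd·y∈ z)
        where
        zd·y≡y : (z ℕ.* d) · y ≡ y
        zd·y≡y = ≈⇒≡ (begin
          (z ℕ.* d) · y       ≡⟨ cong (_· y) 1+qc≡zd ⟨
          y + (q ℕ.* c) · y   ≡⟨ cong (y +_) (multiple-of-c·≡0 q y) ⟩
          y + 0#              ≈⟨ +-identityʳ y ⟩
          y                   ∎)
      cancel (Bézout.+- q z 1+zd≡qc) = ≡.subst (_∈Span bs) -zd·y≡y (-‿∈Span (zd·y∈ z))
        where
        -zd·y≡y : - ((z ℕ.* d) · y) ≡ y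
        -zd·y≡y = ≡.sym (≈⇒≡ (+-inverseʳ-unique ((z ℕ.* d) · y) y (begin
          (z ℕ.* d) · y + y     ≈⟨ +-comm _ y ⟩
          (1 ℕ.+ z ℕ.* d) · y   ≡⟨ cong (_· y) 1+zd≡qc ⟩
          (q ℕ.* c) · y         ≡⟨ multiple-of-c·≡0 q y ⟩
          0#                    ∎)))

    finCombination : ∀ {s} → Vec (Fin c) s → Vec Carrier s → Carrier
    finCombination fs = combination (Vec.map toℕ fs)

    finCombination-∈Span : ∀ {s} {bs : Vec Carrier s} fs → finCombination fs bs ∈Span bs
    finCombination-∈Span fs = Vec.map toℕ fs , ≡.refl

    infix 4 _∈FinSpan_
    _∈FinSpan_ : ∀ {s} → Carrier → Vec Carrier s → Set
    x ∈FinSpan bs = ∃ λ fs → finCombination fs bs ≡ x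

    ∈Span⇒∈FinSpan : ∀ {s} {bs : Vec Carrier s} {x} → x ∈Span bs → x ∈FinSpan bs
    ∈Span⇒∈FinSpan {bs = bs} (ms , ≡.refl) = Vec.map reduce ms , reduce-combination ms bs
      where
      reduce : ℕ → Fin c
      reduce m = Fin.fromℕ< (m%n<n m c)
      reduce-combination : ∀ {s} (ms : Vec ℕ s) bs → finCombination (Vec.map reduce ms) bs ≡ combination ms bs
      reduce-combination []       []       = ≡.refl
      reduce-combination (m ∷ ms) (b ∷ bs) =
        cong₂ _+_ (≡.trans (cong (_· b) (Fin.toℕ-fromℕ< (m%n<n m c))) (≡.sym (·≡·-mod m b)))
                  (reduce-combination ms bs)

    _∈FinSpan?_ : ∀ {s} x (bs : Vec Carrier s) → Dec (x ∈FinSpan bs)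
    _∈FinSpan?_ {s} x bs = ∃? (vecEnumeration (allFinEnumeration c) s) (λ fs → finCombination fs bs ≟ x)

    Independent : ∀ {s} → Vec Carrier s → Set
    Independent bs = ∀ {fs gs} → finCombination fs bs ≡ finCombination gs bs → fs ≡ gs

    []-independent : Independent []
    []-independent {[]} {[]} _ = ≡.refl

    difference-∈Span : ∀ {s} {bs : Vec Carrier s} {y m n S T} → m < n → n < c →
                       m · y + S ≡ n · y + T → S ∈Span bs → T ∈Span bs → y ∈Span bs
    difference-∈Span {bs = bs} {y} {m} {n} {S} {T} m<n n<c eq S∈ T∈ =
      ·-cancel-∈Span (ℕ.m<n⇒0<n∸m m<n) (ℕ.≤-<-trans (ℕ.m∸n≤m n m) n<c)
        (≡.subst (_∈Span bs) S-T≡d·y (+-∈Span S∈ (-‿∈Span T∈)))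
      where
      d = n ℕ.∸ m
      S≡d·y+T : S ≡ d · y + T
      S≡d·y+T = ≈⇒≡ (+-cancelˡ (m · y) S (d · y + T) (begin
        m · y + S              ≡⟨ eq ⟩
        n · y + T              ≡⟨ cong (λ k → k · y + T) (ℕ.m+[n∸m]≡n (ℕ.<⇒≤ m<n)) ⟨
        (m ℕ.+ d) · y + T      ≈⟨ +-congʳ (×-homo-+ y m d) ⟩
        (m · y + d · y) + T    ≈⟨ +-assoc (m · y) (d · y) T ⟩
        m · y + (d · y + T)    ∎))
      S-T≡d·y : S + - T ≡ d · y
      S-T≡d·y = ≈⇒≡ (begin
        S + - T              ≡⟨ cong (_+ - T) S≡d·y+T ⟩
        (d · y + T) + - T    ≈⟨ +-assoc (d · y) T (- T) ⟩
        d · y + (T + - T)    ≈⟨ +-congˡ (-‿inverseʳ T) ⟩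
        d · y + 0#           ≈⟨ +-identityʳ (d · y) ⟩
        d · y                ∎)

    ∷-independent : ∀ {s} {bs : Vec Carrier s} {y} → Independent bs → ¬ (y ∈Span bs) → Independent (y ∷ bs)
    ∷-independent {bs = bs} {y} bs-indep y∉ {a ∷ fs} {b ∷ gs} eq with ℕ.<-cmp (toℕ a) (toℕ b)
    ... | tri< a<b _ _ = contradiction
      (difference-∈Span a<b (Fin.toℕ<n b) eq (finCombination-∈Span fs) (finCombination-∈Span gs)) y∉
    ... | tri> _ _ b<a = contradiction
      (difference-∈Span b<a (Fin.toℕ<n a) (≡.sym eq) (finCombination-∈Span gs) (finCombination-∈Span fs)) y∉
    ... | tri≈ _ a≡b _ = cong₂ _∷_ (Fin.toℕ-injective a≡b)
      (bs-indep (≈⇒≡ (+-cancelˡ (toℕ a · y) _ _ (reflexive (≡.trans eq (cong (λ m → m · y + _) (≡.sym a≡b)))))))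

    combinations : ∀ {s} → Vec Carrier s → List Carrier
    combinations {s} bs = map (λ fs → finCombination fs bs) (elements (vecEnumeration (allFinEnumeration c) s))

    length-combinations : ∀ {s} (bs : Vec Carrier s) → length (combinations bs) ≡ c ^ s
    length-combinations {s} bs = ≡.trans (length-map _ (vectors (List.allFin c) s))
      (≡.trans (length-vectors (List.allFin c) s) (cong (_^ s) (length-allFinEnumeration c)))

    independent⇒c^s≤size : ∀ {s} {bs : Vec Carrier s} → Independent bs → c ^ s ≤ size
    independent⇒c^s≤size {s} {bs} bs-indep = ≡.subst₂ _≤_ (length-combinations bs) length-carriers
      (Unique-⊆⇒length≤ (Unique.map⁺ bs-indep (unique (vecEnumeration (allFinEnumeration c) s)))
                        (λ {x} _ → complete carriers x))

    spans⇒size≤c^s : ∀ {s} {bs : Vec Carrier s} → Spans bs → size ≤ c ^ s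
    spans⇒size≤c^s {s} {bs} bs-spans = ≡.subst₂ _≤_ length-carriers (length-combinations bs)
      (Unique-⊆⇒length≤ (unique carriers) λ {x} _ →
        let fs , fs-comb≡x = ∈Span⇒∈FinSpan (bs-spans x)
        in ≡.subst (_∈ combinations bs) fs-comb≡x (∈-map⁺ _ (complete (vecEnumeration (allFinEnumeration c) s) fs)))

    -- The fuel never runs out: an independent family of length s satisfies s < c ^ s ≤ size.
    extend-to-spanning : ∀ fuel {s} {bs : Vec Carrier (suc s)} →
                         Independent bs → 1# ∈ᵥ bs → size ≤ fuel ℕ.+ suc s →
                         ∃ λ t → ∃ λ (bs′ : Vec Carrier (suc t)) → 1# ∈ᵥ bs′ × Independent bs′ × Spans bs′
    extend-to-spanning fuel {s} {bs} bs-indep 1∈bs size≤ with ∃? carriers (λ y → ¬? (y ∈FinSpan? bs))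
    ... | no nothing-missing =
      s , bs , 1∈bs , bs-indep ,
      λ y → let fs , eq = decidable-stable (y ∈FinSpan? bs) (λ y∉ → nothing-missing (y , y∉)) in Vec.map toℕ fs , eq
    extend-to-spanning zero {s} bs-indep _ size≤ | yes _ =
      contradiction (ℕ.≤-trans (independent⇒c^s≤size bs-indep) size≤)
                    (ℕ.<⇒≱ (n<m^n (nonTrivial⇒n>1 c {{prime⇒nonTrivial c-prime}}) (suc s)))
    extend-to-spanning (suc fuel) {s} bs-indep 1∈bs size≤ | yes (y , y∉) =
      extend-to-spanning fuel (∷-independent bs-indep (y∉ ∘ ∈Span⇒∈FinSpan)) (there 1∈bs)
                         (≡.subst (size ≤_) (≡.sym (ℕ.+-suc fuel (suc s))) size≤)

    [1]-independent : Independent (1# ∷ [])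
    [1]-independent = ∷-independent []-independent λ where ([] , 0≡1) → 0≢1 0≡1

    spanning-basis : ∃ λ s → ∃ λ (bs : Vec Carrier (suc s)) → 1# ∈ᵥ bs × c ^ suc s ≡ size × Spans bs
    spanning-basis
      with s , bs , 1∈bs , bs-indep , bs-spans
             ← extend-to-spanning size [1]-independent (here ≡.refl) (ℕ.m≤m+n size 1) =
      s , bs , 1∈bs , ℕ.≤-antisym (independent⇒c^s≤size bs-indep) (spans⇒size≤c^s bs-spans) , bs-spans

  prime-power-basis : ∀ {p r} → Prime p → size ≡ p ^ r → ∃ λ (bs : Vec Carrier r) → 1# ∈ᵥ bs × Spans bs
  prime-power-basis {p} {r} p-prime size≡p^r
    with c , c-prime , c·1≡0 ← prime-characteristic
    with s , bs , 1∈bs , c^1+s≡size , bs-spans ← Characteristic.spanning-basis c-prime c·1≡0 =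
    ≡.subst (λ t → ∃ λ (bs : Vec Carrier t) → 1# ∈ᵥ bs × Spans bs)
      (prime-powers-injective c-prime p-prime (≡.trans c^1+s≡size size≡p^r)) (bs , 1∈bs , bs-spans)

  -- Vectors over F and grids

  lookup-ext : ∀ {A : Set} {n} {u v : Vec A n} → (∀ i → lookup u i ≡ lookup v i) → u ≡ v
  lookup-ext {u = u} {v} eq = ≡.trans (≡.sym (tabulate∘lookup u)) (≡.trans (tabulate-cong eq) (tabulate∘lookup v))

  infixl 6 _+v_
  infixr 7 _·v_

  _+v_ : ∀ {n} → Vec Carrier n → Vec Carrier n → Vec Carrier n
  _+v_ = _+ᵛ_ F

  _·v_ : ∀ {n} → Carrier → Vec Carrier n → Vec Carrier n
  _·v_ = _·ᵛ_ F

  0v : ∀ {n} → Vec Carrier n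
  0v = zeroV F

  lookup-+v : ∀ {n} (u v : Vec Carrier n) i → lookup (u +v v) i ≡ lookup u i + lookup v i
  lookup-+v u v i = lookup-zipWith _+_ i u v

  lookup-·v : ∀ {n} a (v : Vec Carrier n) i → lookup (a ·v v) i ≡ a * lookup v i
  lookup-·v a v i = lookup-map i (a *_) v

  lookup-0v : ∀ {n} (i : Fin n) → lookup 0v i ≡ 0#
  lookup-0v i = lookup-replicate i 0#

  sum : ∀ {n} → Vec Carrier n → Carrier
  sum = Vec.foldr _ _+_ 0#

  sum-+v : ∀ {n} (u v : Vec Carrier n) → sum (u +v v) ≈ sum u + sum v
  sum-+v []      []      = sym (+-identityˡ 0#)
  sum-+v (a ∷ u) (b ∷ v) = begin
    (a + b) + sum (u +v v)      ≈⟨ +-congˡ (sum-+v u v) ⟩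
    (a + b) + (sum u + sum v)   ≈⟨ interchange a b (sum u) (sum v) ⟩
    (a + sum u) + (b + sum v)   ∎
    where open import Algebra.Properties.CommutativeSemigroup +-commutativeSemigroup using (interchange)

  sum-·v : ∀ {n} a (v : Vec Carrier n) → sum (a ·v v) ≈ a * sum v
  sum-·v a []      = sym (zeroʳ a)
  sum-·v a (b ∷ v) = trans (+-congˡ (sum-·v a v)) (sym (distribˡ a b (sum v)))

  sum-0v : ∀ n → sum (0v {n}) ≈ 0#
  sum-0v zero    = refl
  sum-0v (suc n) = trans (+-identityˡ _) (sum-0v n)

  single : ∀ {n} → Fin n → Carrier → Vec Carrier n
  single j x = 0v [ j ]≔ x

  lookup-single-≡ : ∀ {n} (j : Fin n) x → lookup (single j x) j ≡ x
  lookup-single-≡ j x = lookup∘update j 0v x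

  lookup-single-≢ : ∀ {n} {i j : Fin n} x → i ≢ j → lookup (single j x) i ≡ 0#
  lookup-single-≢ {i = i} x i≢j = ≡.trans (lookup∘update′ i≢j 0v x) (lookup-0v i)

  sum-single : ∀ {n} (j : Fin n) x → sum (single j x) ≈ x
  sum-single {suc n} Fin.zero    x = trans (+-congˡ (sum-0v n)) (+-identityʳ x)
  sum-single         (Fin.suc j) x = trans (+-identityˡ _) (sum-single j x)

  skewSum : ∀ {n} → Carrier → Vec Carrier (suc n) → Carrier
  skewSum b (a ∷ as) = a + b * sum as

  skewSum-+v : ∀ {n} b (u v : Vec Carrier (suc n)) → skewSum b (u +v v) ≡ skewSum b u + skewSum b v
  skewSum-+v b (x ∷ u) (y ∷ v) = ≈⇒≡ (begin
    (x + y) + b * sum (u +v v)           ≈⟨ +-congˡ (*-congˡ (sum-+v u v)) ⟩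
    (x + y) + b * (sum u + sum v)        ≈⟨ +-congˡ (distribˡ b (sum u) (sum v)) ⟩
    (x + y) + (b * sum u + b * sum v)    ≈⟨ interchange x y (b * sum u) (b * sum v) ⟩
    (x + b * sum u) + (y + b * sum v)    ∎)
    where open import Algebra.Properties.CommutativeSemigroup +-commutativeSemigroup using (interchange)

  skewSum-·v : ∀ {n} b a (v : Vec Carrier (suc n)) → skewSum b (a ·v v) ≡ a * skewSum b v
  skewSum-·v b a (x ∷ v) = ≈⇒≡ (begin
    a * x + b * sum (a ·v v)    ≈⟨ +-congˡ (*-congˡ (sum-·v a v)) ⟩
    a * x + b * (a * sum v)     ≈⟨ +-congˡ (x∙yz≈y∙xz b a (sum v)) ⟩
    a * x + a * (b * sum v)     ≈⟨ distribˡ a x (b * sum v) ⟨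
    a * (x + b * sum v)         ∎)
    where open import Algebra.Properties.CommutativeSemigroup *-commutativeSemigroup using (x∙yz≈y∙xz)

  skewSum-head : ∀ {n} b x → skewSum b (x ∷ 0v {n}) ≡ x
  skewSum-head {n} b x = ≈⇒≡ (trans (+-congˡ (trans (*-congˡ (sum-0v n)) (zeroʳ b))) (+-identityʳ x))

  skewSum-∷single : ∀ {n} b a (j : Fin n) x → skewSum b (a ∷ single j x) ≡ a + b * x
  skewSum-∷single b a j x = ≈⇒≡ (+-congˡ (*-congˡ (sum-single j x)))

  lincomb-map : ∀ {k m n} (f : Vec Carrier m → Vec Carrier n) →
                f 0v ≡ 0v → (∀ u v → f (u +v v) ≡ f u +v f v) → (∀ a v → f (a ·v v) ≡ a ·v f v) →
                ∀ (α : Vec Carrier k) bs → lincomb F α (Vec.map f bs) ≡ f (lincomb F α bs)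
  lincomb-map f f-0 f-+ f-· []      []       = ≡.sym f-0
  lincomb-map f f-0 f-+ f-· (a ∷ α) (b ∷ bs) =
    ≡.trans (cong₂ _+v_ (≡.sym (f-· a b)) (lincomb-map f f-0 f-+ f-· α bs)) (≡.sym (f-+ (a ·v b) (lincomb F α bs)))

  +v-identityˡ : ∀ {n} (v : Vec Carrier n) → 0v +v v ≡ v
  +v-identityˡ []      = ≡.refl
  +v-identityˡ (x ∷ v) = cong₂ _∷_ (≈⇒≡ (+-identityˡ x)) (+v-identityˡ v)

  ·v-zeroʳ : ∀ {n} a → a ·v 0v {n} ≡ 0v
  ·v-zeroʳ {zero}  a = ≡.refl
  ·v-zeroʳ {suc n} a = cong₂ _∷_ (≈⇒≡ (zeroʳ a)) (·v-zeroʳ a)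

  standardBasis : ∀ n → Vec (Vec Carrier n) n
  standardBasis zero    = []
  standardBasis (suc n) = (1# ∷ 0v) ∷ Vec.map (0# ∷_) (standardBasis n)

  lincomb-standardBasis : ∀ {n} (α : Vec Carrier n) → lincomb F α (standardBasis n) ≡ α
  lincomb-standardBasis []      = ≡.refl
  lincomb-standardBasis (a ∷ α) =
    ≡.trans (cong (a ·v (1# ∷ 0v) +v_) (lincomb-map (0# ∷_) ≡.refl 0∷-+ 0∷-· α (standardBasis _)))
            (cong₂ _∷_ (≈⇒≡ (trans (+-identityʳ _) (*-identityʳ a)))
                       (≡.trans (cong (_+v _) (·v-zeroʳ a)) (≡.trans (+v-identityˡ _) (lincomb-standardBasis α))))
    where
    0∷-+ : ∀ {n} (u v : Vec Carrier n) → 0# ∷ (u +v v) ≡ (0# ∷ u) +v (0# ∷ v)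
    0∷-+ u v = cong (_∷ (u +v v)) (≈⇒≡ (sym (+-identityˡ 0#)))
    0∷-· : ∀ {n} b (v : Vec Carrier n) → 0# ∷ (b ·v v) ≡ b ·v (0# ∷ v)
    0∷-· b v = cong (_∷ (b ·v v)) (≈⇒≡ (sym (zeroʳ b)))

  grid : ∀ {k n} → Vec (Vec Carrier n) k → Vec Carrier n → Vec Carrier k → Vec (Vec Carrier n) k
  grid x d α = _+ᵍ_ F x (_⊗_ F α d)

  fromColumns : ∀ {k n} → (Fin n → Vec Carrier k) → Vec (Vec Carrier n) k
  fromColumns f = tabulate λ j → tabulate λ i → lookup (f i) j

  lookup-column : ∀ {k n} (i : Fin n) (y : Vec (Vec Carrier n) k) j → lookup (column F i y) j ≡ lookup (lookup y j) i
  lookup-column i y j = lookup-map j (λ v → lookup v i) y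

  column-fromColumns : ∀ {k n} (f : Fin n → Vec Carrier k) i → column F i (fromColumns f) ≡ f i
  column-fromColumns f i = lookup-ext λ j →
    ≡.trans (lookup-column i (fromColumns f) j)
      (≡.trans (cong (λ v → lookup v i) (lookup∘tabulate (λ j → tabulate λ i → lookup (f i) j) j))
               (lookup∘tabulate (λ i → lookup (f i) j) i))

  column-ext : ∀ {k n} {y y′ : Vec (Vec Carrier n) k} → (∀ i → column F i y ≡ column F i y′) → y ≡ y′
  column-ext {y = y} {y′} eq = lookup-ext λ j → lookup-ext λ i →
    ≡.trans (≡.sym (lookup-column i y j)) (≡.trans (cong (λ v → lookup v j) (eq i)) (lookup-column i y′ j))

  column-grid : ∀ {k n} (x : Vec (Vec Carrier n) k) d α i → column F i (grid x d α) ≡ column F i x +v lookup d i ·v α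
  column-grid x d α i = lookup-ext entry
    where
    entry : ∀ j → lookup (column F i (grid x d α)) j ≡ lookup (column F i x +v lookup d i ·v α) j
    entry j = ≈⇒≡ (begin
      lookup (column F i (grid x d α)) j         ≡⟨ lookup-column i (grid x d α) j ⟩
      lookup (lookup (grid x d α) j) i           ≡⟨ cong (λ v → lookup v i) (lookup-zipWith _+v_ j x (_⊗_ F α d)) ⟩
      lookup (xⱼ +v lookup (_⊗_ F α d) j) i      ≡⟨ cong (λ v → lookup (xⱼ +v v) i) (lookup-map j (_·v d) α) ⟩
      lookup (xⱼ +v lookup α j ·v d) i           ≡⟨ lookup-+v xⱼ (lookup α j ·v d) i ⟩
      lookup xⱼ i + lookup (lookup α j ·v d) i   ≡⟨ cong₂ _+_ (≡.sym (lookup-column i x j)) (lookup-·v (lookup α j) d i) ⟩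
      xᵢⱼ + lookup α j * lookup d i              ≈⟨ +-congˡ (*-comm _ _) ⟩
      xᵢⱼ + lookup d i * lookup α j              ≡⟨ cong (xᵢⱼ +_) (lookup-·v (lookup d i) α j) ⟨
      xᵢⱼ + lookup (lookup d i ·v α) j           ≡⟨ lookup-+v (column F i x) _ j ⟨
      lookup (column F i x +v lookup d i ·v α) j ∎)
      where
      xⱼ = lookup x j
      xᵢⱼ = lookup (column F i x) j

  nonzero-entry : ∀ {n} {d : Vec Carrier n} → d ≢ 0v → ∃ λ i → lookup d i ≢ 0#
  nonzero-entry {n} {d} d≢0 = Fin.¬∀⟶∃¬ n (λ i → lookup d i ≡ 0#) (λ i → lookup d i ≟ 0#)
    λ all-zero → d≢0 (lookup-ext λ i → ≡.trans (all-zero i) (≡.sym (lookup-0v i)))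

  column-grid-onto : ∀ {k n} (x : Vec (Vec Carrier n) k) {d i} → lookup d i ≢ 0# →
                     ∀ α → ∃ λ γ → column F i (grid x d γ) ≡ α
  column-grid-onto x {d} {i} dᵢ≢0 α = γ , ≡.trans (column-grid x d γ i) (lookup-ext column-i)
    where
    dᵢ = lookup d i
    u = proj₁ (inverse dᵢ (dᵢ≢0 ∘ ≈⇒≡))
    dᵢu≈1 : dᵢ * u ≈ 1#
    dᵢu≈1 = proj₂ (inverse dᵢ (dᵢ≢0 ∘ ≈⇒≡))
    xᵢ = column F i x
    α-xᵢ = α +v (- 1#) ·v xᵢ
    γ = u ·v α-xᵢ
    column-i : ∀ j → lookup (column F i x +v dᵢ ·v γ) j ≡ lookup α j
    column-i j = ≈⇒≡ (begin
      lookup (column F i x +v dᵢ ·v u ·v α-xᵢ) j    ≡⟨ lookup-+v (column F i x) (dᵢ ·v u ·v α-xᵢ) j ⟩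
      c + lookup (dᵢ ·v u ·v α-xᵢ) j                ≡⟨ cong (c +_) (lookup-·v dᵢ (u ·v α-xᵢ) j) ⟩
      c + dᵢ * lookup (u ·v α-xᵢ) j                 ≡⟨ cong (λ z → c + dᵢ * z) (lookup-·v u α-xᵢ j) ⟩
      c + dᵢ * (u * lookup α-xᵢ j)                  ≡⟨ cong (λ z → c + dᵢ * (u * z)) (lookup-+v α _ j) ⟩
      c + dᵢ * (u * (a + lookup ((- 1#) ·v xᵢ) j))  ≡⟨ cong (λ z → c + dᵢ * (u * (a + z))) (lookup-·v (- 1#) xᵢ j) ⟩
      c + dᵢ * (u * (a + (- 1#) * c))               ≈⟨ +-congˡ (*-assoc dᵢ u _) ⟨
      c + (dᵢ * u) * (a + (- 1#) * c)               ≈⟨ +-congˡ (trans (*-congʳ dᵢu≈1) (*-identityˡ _)) ⟩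
      c + (a + (- 1#) * c)                          ≈⟨ x+[y-x]≈y c a ⟩
      a                                             ∎)
      where
      a = lookup α j
      c = lookup (column F i x) j

  affine-columns⇒grid : ∀ {k n} (g : Vec Carrier k → Vec (Vec Carrier n) k) (δ : Fin n → Carrier) →
                        (∀ i α → column F i (g α) ≡ column F i (g 0v) +v δ i ·v α) →
                        ∀ α → g α ≡ grid (g 0v) (tabulate δ) α
  affine-columns⇒grid g δ g-affine α = column-ext λ i → ≡.trans (g-affine i α) (≡.sym
    (≡.trans (column-grid (g 0v) (tabulate δ) α i)
             (cong (λ δᵢ → column F i (g 0v) +v δᵢ ·v α) (lookup∘tabulate δ i))))

  slope-of-identity : ∀ {k} {b : Vec Carrier (suc k)} {δ} → (∀ α → α ≡ b +v δ ·v α) → δ ≡ 1#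
  slope-of-identity {k} {b₀ ∷ _} {δ} id≡affine = ≈⇒≡ (begin
    δ              ≈⟨ *-identityʳ δ ⟨
    δ * 1#         ≈⟨ +-identityˡ (δ * 1#) ⟨
    0# + δ * 1#    ≈⟨ +-congʳ b₀≈0 ⟨
    b₀ + δ * 1#    ≡⟨ cong Vec.head (id≡affine (1# ∷ 0v)) ⟨
    1#             ∎)
    where
    b₀≈0 : b₀ ≈ 0#
    b₀≈0 = begin
      b₀             ≈⟨ +-identityʳ b₀ ⟨
      b₀ + 0#        ≈⟨ +-congˡ (zeroʳ δ) ⟨
      b₀ + δ * 0#    ≡⟨ cong Vec.head (id≡affine 0v) ⟨
      0#             ∎

  module _ {k n : ℕ} where

    containsGrid? : ∀ A → Dec (ContainsGrid F k n A)
    containsGrid? A =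
      ∃? (vecEnumeration (vecEnumeration carriers n) k) λ x →
      ∃? (vecEnumeration carriers n) λ d →
      ¬? (≡-dec _≟_ d 0v) ×-dec ∀? (vecEnumeration carriers k) (λ α → grid x d α ∈? A)
      where open import Data.List.Membership.DecPropositional (≡-dec (≡-dec _≟_)) using (_∈?_)

    maxSize-gridFree : ∃ (MaxSize (λ A → ¬ ContainsGrid F k n A))
    maxSize-gridFree = maxSize-exists (≡-dec (≡-dec _≟_)) (vecEnumeration (vecEnumeration carriers n) k)
      (λ A → ¬? (containsGrid? A))
      (λ (_ , _ , _ , grid⊆[]) → case grid⊆[] 0v of λ ())
      (λ W⊆W′ W′⊆W no-grid (x , d , d≢0 , grid⊆W′) → no-grid (x , d , d≢0 , W′⊆W ∘ grid⊆W′))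

  -- Maps preserving the fibres of the coordinate functionals of Q are affine

  PreservesFibres : {A B : Set} → (A → B) → (A → A) → Set
  PreservesFibres φ h = ∀ {α α′} → φ α ≡ φ α′ → φ (h α) ≡ φ (h α′)

  preservesFibres-+v : ∀ {m} {φ : Vec Carrier m → Carrier} {h} w → (∀ u v → φ (u +v v) ≡ φ u + φ v) →
                       PreservesFibres φ h → PreservesFibres φ (λ α → h α +v w)
  preservesFibres-+v {φ = φ} {h} w φ-+ h-pres {α} {α′} φα≡φα′ =
    ≡.trans (φ-+ (h α) w) (≡.trans (cong (_+ φ w) (h-pres φα≡φα′)) (≡.sym (φ-+ (h α′) w)))

  preservesFibres-cong : ∀ {m} {φ ψ : Vec Carrier m → Carrier} {h} → (∀ α → φ α ≡ ψ α) →
                         PreservesFibres φ h → PreservesFibres ψ h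
  preservesFibres-cong {h = h} φ≗ψ h-pres {α} {α′} ψα≡ψα′ =
    ≡.trans (≡.sym (φ≗ψ (h α)))
      (≡.trans (h-pres (≡.trans (φ≗ψ α) (≡.trans ψα≡ψα′ (≡.sym (φ≗ψ α′))))) (φ≗ψ (h α′)))

  module LinearRigidity {r} {Λ : Vec Carrier r} (1∈Λ : 1# ∈ᵥ Λ) (Λ-spans : Spans Λ)
                        {k′} (h : Vec Carrier (2 ℕ.+ k′) → Vec Carrier (2 ℕ.+ k′)) (h-0 : h 0v ≡ 0v)
                        (h-coord : ∀ j → PreservesFibres (λ α → lookup α j) h)
                        (h-skew : ∀ l → PreservesFibres (skewSum (lookup Λ l)) h) where

    ψ : Fin (2 ℕ.+ k′) → Carrier → Carrier
    ψ j x = lookup (h (single j x)) j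

    lookup-h : ∀ α j → lookup (h α) j ≡ ψ j (lookup α j)
    lookup-h α j = h-coord j (≡.sym (lookup-single-≡ j (lookup α j)))

    ψ-0 : ∀ j → ψ j 0# ≡ 0#
    ψ-0 j = ≈⇒≡ (begin
      ψ j 0#             ≡⟨ cong (ψ j) (lookup-0v j) ⟨
      ψ j (lookup 0v j)  ≡⟨ lookup-h 0v j ⟨
      lookup (h 0v) j    ≡⟨ cong (λ v → lookup v j) h-0 ⟩
      lookup 0v j        ≡⟨ lookup-0v j ⟩
      0#                 ∎)

    h-single : ∀ j x → h (single j x) ≡ single j (ψ j x)
    h-single j x = lookup-ext λ i → lookup-h-single i (i Fin.≟ j)
      where
      lookup-h-single : ∀ i → Dec (i ≡ j) → lookup (h (single j x)) i ≡ lookup (single j (ψ j x)) i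
      lookup-h-single i (yes ≡.refl) = ≡.sym (lookup-single-≡ j (ψ j x))
      lookup-h-single i (no i≢j)     = ≈⇒≡ (begin
        lookup (h (single j x)) i      ≡⟨ lookup-h (single j x) i ⟩
        ψ i (lookup (single j x) i)    ≡⟨ cong (ψ i) (lookup-single-≢ x i≢j) ⟩
        ψ i 0#                         ≡⟨ ψ-0 i ⟩
        0#                             ≡⟨ lookup-single-≢ (ψ j x) i≢j ⟨
        lookup (single j (ψ j x)) i    ∎)

    A : Carrier → Carrier
    A = ψ Fin.zero

    e₀ : Carrier → Vec Carrier (2 ℕ.+ k′)
    e₀ = single Fin.zero

    skewSum-e₀ : ∀ b x → skewSum b (e₀ x) ≡ x
    skewSum-e₀ = skewSum-head {suc k′}

    ψ-suc : ∀ l j x → lookup Λ l * ψ (Fin.suc j) x ≡ A (lookup Λ l * x)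
    ψ-suc l j x = ≈⇒≡ (begin
      b * ψ (Fin.suc j) x                              ≈⟨ +-identityˡ _ ⟨
      0# + b * ψ (Fin.suc j) x                         ≡⟨ skewSum-∷single b 0# j (ψ (Fin.suc j) x) ⟨
      skewSum b (single (Fin.suc j) (ψ (Fin.suc j) x)) ≡⟨ cong (skewSum b) (h-single (Fin.suc j) x) ⟨
      skewSum b (h (single (Fin.suc j) x))             ≡⟨ h-skew l same-skewSum ⟩
      skewSum b (h (e₀ (b * x)))                       ≡⟨ cong (skewSum b) (h-single Fin.zero (b * x)) ⟩
      skewSum b (e₀ (A (b * x)))                       ≡⟨ skewSum-e₀ b (A (b * x)) ⟩
      A (b * x)                                        ∎)
      where
      b = lookup Λ l
      same-skewSum : skewSum b (single (Fin.suc j) x) ≡ skewSum b (e₀ (b * x))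
      same-skewSum = ≡.trans (skewSum-∷single b 0# j x)
                       (≡.trans (≈⇒≡ (+-identityˡ (b * x))) (≡.sym (skewSum-e₀ b (b * x))))

    l₁ : Fin r
    l₁ = Anyᵥ.index 1∈Λ

    Λ[l₁]≡1 : lookup Λ l₁ ≡ 1#
    Λ[l₁]≡1 = ≡.sym (lookup-indexᵥ 1∈Λ)

    ψ≡A : ∀ j x → ψ j x ≡ A x
    ψ≡A Fin.zero    x = ≡.refl
    ψ≡A (Fin.suc j) x = ≈⇒≡ (begin
      ψ (Fin.suc j) x                ≈⟨ *-identityˡ _ ⟨
      1# * ψ (Fin.suc j) x           ≡⟨ cong (_* ψ (Fin.suc j) x) Λ[l₁]≡1 ⟨
      lookup Λ l₁ * ψ (Fin.suc j) x  ≡⟨ ψ-suc l₁ j x ⟩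
      A (lookup Λ l₁ * x)            ≡⟨ cong (λ b → A (b * x)) Λ[l₁]≡1 ⟩
      A (1# * x)                     ≡⟨ cong A (≈⇒≡ (*-identityˡ x)) ⟩
      A x                            ∎)

    h≡map : ∀ α → h α ≡ Vec.map A α
    h≡map α = lookup-ext λ j → ≡.trans (lookup-h α j) (≡.trans (ψ≡A j (lookup α j)) (≡.sym (lookup-map j A α)))

    map-A-0v : ∀ {n} → Vec.map A (0v {n}) ≡ 0v
    map-A-0v {n} = ≡.trans (map-replicate A 0# n) (cong (Vec.replicate n) (ψ-0 Fin.zero))

    A-+ : ∀ x y → A (x + y) ≡ A x + A y
    A-+ x y = ≈⇒≡ (begin
      A (x + y)                                    ≡⟨ skewSum-e₀ 1# (A (x + y)) ⟨
      skewSum 1# (e₀ (A (x + y)))                  ≡⟨ cong (skewSum 1#) (h-single Fin.zero (x + y)) ⟨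
      skewSum 1# (h (e₀ (x + y)))                  ≡⟨ h-skew₁ same-skewSum ⟨
      skewSum 1# (h x∷y∷0)                         ≡⟨ cong (skewSum 1#) (h≡map x∷y∷0) ⟩
      skewSum 1# (A x ∷ A y ∷ Vec.map A (0v {k′})) ≡⟨ cong (λ v → skewSum 1# (A x ∷ A y ∷ v)) (map-A-0v {k′}) ⟩
      skewSum 1# (A x ∷ A y ∷ 0v {k′})             ≡⟨ skewSum-∷single 1# (A x) (Fin.zero {k′}) (A y) ⟩
      A x + 1# * A y                               ≈⟨ +-congˡ (*-identityˡ (A y)) ⟩
      A x + A y                                    ∎)
      where
      x∷y∷0 : Vec Carrier (2 ℕ.+ k′)
      x∷y∷0 = x ∷ y ∷ 0v
      h-skew₁ : PreservesFibres (skewSum 1#) h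
      h-skew₁ = ≡.subst (λ b → PreservesFibres (skewSum b) h) Λ[l₁]≡1 (h-skew l₁)
      same-skewSum : skewSum 1# x∷y∷0 ≡ skewSum 1# (e₀ (x + y))
      same-skewSum = ≡.trans (skewSum-∷single 1# x (Fin.zero {k′}) y)
                       (≡.trans (cong (x +_) (≈⇒≡ (*-identityˡ y))) (≡.sym (skewSum-e₀ 1# (x + y))))

    A-*Λ : ∀ l x → A (lookup Λ l * x) ≡ lookup Λ l * A x
    A-*Λ l x = ≡.trans (≡.sym (ψ-suc l Fin.zero x)) (cong (lookup Λ l *_) (ψ≡A (Fin.suc Fin.zero) x))

    A-* : ∀ c x → A (c * x) ≡ c * A x
    A-* = *-homo-by-spanning A-+ Λ-spans A-*Λ

    h-linear : ∀ α → h α ≡ A 1# ·v α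
    h-linear α = lookup-ext λ j → ≈⇒≡ (begin
      lookup (h α) j          ≡⟨ cong (λ v → lookup v j) (h≡map α) ⟩
      lookup (Vec.map A α) j  ≡⟨ lookup-map j A α ⟩
      A (lookup α j)          ≡⟨ cong A (≈⇒≡ (*-identityʳ _)) ⟨
      A (lookup α j * 1#)     ≡⟨ A-* (lookup α j) 1# ⟩
      lookup α j * A 1#       ≈⟨ *-comm _ _ ⟩
      A 1# * lookup α j       ≡⟨ lookup-·v (A 1#) α j ⟨
      lookup (A 1# ·v α) j    ∎)

  preservesFibres⇒affine : ∀ {r} {Λ : Vec Carrier r} → 1# ∈ᵥ Λ → Spans Λ →
                           ∀ {k′} (h : Vec Carrier (2 ℕ.+ k′) → Vec Carrier (2 ℕ.+ k′)) →
                           (∀ j → PreservesFibres (λ α → lookup α j) h) →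
                           (∀ l → PreservesFibres (skewSum (lookup Λ l)) h) →
                           ∃ λ δ → ∀ α → h α ≡ h 0v +v δ ·v α
  preservesFibres⇒affine {Λ = Λ} 1∈Λ Λ-spans {k′} h h-coord h-skew = A 1# , h-affine
    where
    -h0 : Vec Carrier (2 ℕ.+ k′)
    -h0 = (- 1#) ·v h 0v

    h₀ : Vec Carrier (2 ℕ.+ k′) → Vec Carrier (2 ℕ.+ k′)
    h₀ α = h α +v -h0

    x+-1*x≈0 : ∀ x → x + (- 1#) * x ≈ 0#
    x+-1*x≈0 x = trans (+-congˡ (-1*x≈-x x)) (-‿inverseʳ x)

    h₀-0 : h₀ 0v ≡ 0v
    h₀-0 = lookup-ext λ j → ≈⇒≡ (begin
      lookup (h 0v +v -h0) j                     ≡⟨ lookup-+v (h 0v) -h0 j ⟩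
      lookup (h 0v) j + lookup -h0 j             ≡⟨ cong (lookup (h 0v) j +_) (lookup-·v (- 1#) (h 0v) j) ⟩
      lookup (h 0v) j + (- 1#) * lookup (h 0v) j ≈⟨ x+-1*x≈0 (lookup (h 0v) j) ⟩
      0#                                         ≡⟨ lookup-0v j ⟨
      lookup 0v j                                ∎)

    open LinearRigidity 1∈Λ Λ-spans h₀ h₀-0
      (λ j → preservesFibres-+v {h = h} -h0 (λ u v → lookup-+v u v j) (h-coord j))
      (λ l → preservesFibres-+v {h = h} -h0 (skewSum-+v (lookup Λ l)) (h-skew l))

    h-affine : ∀ α → h α ≡ h 0v +v A 1# ·v α
    h-affine α = ≡.trans (lookup-ext h≡h0+h₀) (cong (h 0v +v_) (h-linear α))
      where
      h≡h0+h₀ : ∀ j → lookup (h α) j ≡ lookup (h 0v +v h₀ α) j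
      h≡h0+h₀ j = ≈⇒≡ (begin
        y                          ≈⟨ x+[y-x]≈y x y ⟨
        x + (y + (- 1#) * x)       ≡⟨ cong (λ z → x + (y + z)) (lookup-·v (- 1#) (h 0v) j) ⟨
        x + (y + lookup -h0 j)     ≡⟨ cong (x +_) (lookup-+v (h α) -h0 j) ⟨
        x + lookup (h₀ α) j        ≡⟨ lookup-+v (h 0v) (h₀ α) j ⟨
        lookup (h 0v +v h₀ α) j    ∎)
        where
        x = lookup (h 0v) j
        y = lookup (h α) j

  -- The subspace Q, and grids versus forbidden subgraphs

  module Construction {k′ r : ℕ} (Λ : Vec Carrier r) where

    k : ℕ
    k = 2 ℕ.+ k′

    functional : Fin (k ℕ.+ r) → Vec Carrier k → Carrier
    functional p = [ (λ j α → lookup α j) , (λ l → skewSum (lookup Λ l)) ]′ (Fin.splitAt k p)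

    functional-↑ˡ : ∀ j α → functional (j ↑ˡ r) α ≡ lookup α j
    functional-↑ˡ j α rewrite Fin.splitAt-↑ˡ k j r = ≡.refl

    functional-↑ʳ : ∀ l α → functional (k ↑ʳ l) α ≡ skewSum (lookup Λ l) α
    functional-↑ʳ l α rewrite Fin.splitAt-↑ʳ k r l = ≡.refl

    functional-+v : ∀ p u v → functional p (u +v v) ≡ functional p u + functional p v
    functional-+v p u v with Fin.splitAt k p
    ... | inj₁ j = lookup-+v u v j
    ... | inj₂ l = skewSum-+v (lookup Λ l) u v

    functional-·v : ∀ p a v → functional p (a ·v v) ≡ a * functional p v
    functional-·v p a v with Fin.splitAt k p
    ... | inj₁ j = lookup-·v a v j
    ... | inj₂ l = skewSum-·v (lookup Λ l) a v

    embed : Vec Carrier k → Vec Carrier (k ℕ.+ r)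
    embed α = tabulate λ p → functional p α

    lookup-embed : ∀ α p → lookup (embed α) p ≡ functional p α
    lookup-embed α p = lookup∘tabulate (λ p → functional p α) p

    project : Vec Carrier (k ℕ.+ r) → Vec Carrier k
    project x = tabulate λ j → lookup x (j ↑ˡ r)

    project-embed : ∀ α → project (embed α) ≡ α
    project-embed α = lookup-ext λ j →
      ≡.trans (lookup∘tabulate (λ j → lookup (embed α) (j ↑ˡ r)) j)
              (≡.trans (lookup-embed α (j ↑ˡ r)) (functional-↑ˡ j α))

    embed-injective : ∀ {α β} → embed α ≡ embed β → α ≡ β
    embed-injective {α} {β} eq = ≡.trans (≡.sym (project-embed α)) (≡.trans (cong project eq) (project-embed β))

    Q : Vec Carrier (k ℕ.+ r) → Set
    Q x = ∃ λ α → x ≡ embed α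

    embed-0v : embed 0v ≡ 0v
    embed-0v = lookup-ext λ p → ≈⇒≡ (begin
      lookup (embed 0v) p        ≡⟨ lookup-embed 0v p ⟩
      functional p 0v            ≡⟨ cong (functional p) (·v-zeroʳ 0#) ⟨
      functional p (0# ·v 0v)    ≡⟨ functional-·v p 0# 0v ⟩
      0# * functional p 0v       ≈⟨ zeroˡ _ ⟩
      0#                         ≡⟨ lookup-0v p ⟨
      lookup 0v p                ∎)

    embed-+v : ∀ u v → embed (u +v v) ≡ embed u +v embed v
    embed-+v u v = lookup-ext λ p → ≈⇒≡ (begin
      lookup (embed (u +v v)) p                        ≡⟨ lookup-embed (u +v v) p ⟩
      functional p (u +v v)                            ≡⟨ functional-+v p u v ⟩
      functional p u + functional p v                  ≡⟨ cong₂ _+_ (lookup-embed u p) (lookup-embed v p) ⟨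
      lookup (embed u) p + lookup (embed v) p          ≡⟨ lookup-+v (embed u) (embed v) p ⟨
      lookup (embed u +v embed v) p                    ∎)

    embed-·v : ∀ a v → embed (a ·v v) ≡ a ·v embed v
    embed-·v a v = lookup-ext λ p → ≈⇒≡ (begin
      lookup (embed (a ·v v)) p     ≡⟨ lookup-embed (a ·v v) p ⟩
      functional p (a ·v v)         ≡⟨ functional-·v p a v ⟩
      a * functional p v            ≡⟨ cong (a *_) (lookup-embed v p) ⟨
      a * lookup (embed v) p        ≡⟨ lookup-·v a (embed v) p ⟨
      lookup (a ·v embed v) p       ∎)

    basis : Vec (Vec Carrier (k ℕ.+ r)) k
    basis = Vec.map embed (standardBasis k)

    lincomb-basis : ∀ α → lincomb F α basis ≡ embed α
    lincomb-basis α = ≡.trans (lincomb-map embed embed-0v embed-+v embed-·v α (standardBasis k))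
                              (cong embed (lincomb-standardBasis α))

    Q-isSubspace : IsSubspaceOfDim F (k ℕ.+ r) k Q
    Q-isSubspace = basis , independent , λ x →
      mk⇔ (λ (α , x≡embedα) → α , ≡.trans x≡embedα (≡.sym (lincomb-basis α)))
          (λ (α , x≡lincomb) → α , ≡.trans x≡lincomb (lincomb-basis α))
      where
      independent : LinIndep F basis
      independent α eq = embed-injective (≡.trans (≡.sym (lincomb-basis α)) (≡.trans eq (≡.sym embed-0v)))

    points : List (Vec Carrier k)
    points = elements (vecEnumeration carriers k)

    q : ℕ
    q = length points

    Q-card : Card Q q
    Q-card = Card-image (vecEnumeration carriers k) embed embed-injective

    q≡size^k : q ≡ size ^ k
    q≡size^k = ≡.trans (length-vectors (elements carriers) k) (cong (_^ k) length-carriers)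

    module _ {n : ℕ} where

      toQⁿ : Vec (Vec Carrier n) k → Vec (Vec Carrier (k ℕ.+ r)) n
      toQⁿ y = tabulate λ i → embed (column F i y)

      fromQⁿ : Vec (Vec Carrier (k ℕ.+ r)) n → Vec (Vec Carrier n) k
      fromQⁿ z = fromColumns λ i → project (lookup z i)

      lookup-toQⁿ : ∀ y i → lookup (toQⁿ y) i ≡ embed (column F i y)
      lookup-toQⁿ y i = lookup∘tabulate (λ i → embed (column F i y)) i

      fromQⁿ-toQⁿ : ∀ y → fromQⁿ (toQⁿ y) ≡ y
      fromQⁿ-toQⁿ y = column-ext λ i →
        ≡.trans (column-fromColumns (λ i → project (lookup (toQⁿ y) i)) i)
                (≡.trans (cong project (lookup-toQⁿ y i)) (project-embed (column F i y)))

      toQⁿ-injective : ∀ {y y′} → toQⁿ y ≡ toQⁿ y′ → y ≡ y′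
      toQⁿ-injective {y} {y′} eq = ≡.trans (≡.sym (fromQⁿ-toQⁿ y)) (≡.trans (cong fromQⁿ eq) (fromQⁿ-toQⁿ y′))

      toQⁿ-fromQⁿ : ∀ {z} → InPow F Q n z → toQⁿ (fromQⁿ z) ≡ z
      toQⁿ-fromQⁿ {z} z∈Qⁿ = lookup-ext λ i → let α , zᵢ≡embedα = z∈Qⁿ i in
        ≡.trans (lookup-toQⁿ (fromQⁿ z) i) (≡.trans (cong embed (column-fromColumns (λ i → project (lookup z i)) i))
          (≡.trans (cong (embed ∘ project) zᵢ≡embedα) (≡.trans (cong embed (project-embed α)) (≡.sym zᵢ≡embedα))))

      toQⁿ∈Qⁿ : ∀ y → InPow F Q n (toQⁿ y)
      toQⁿ∈Qⁿ y i = column F i y , lookup-toQⁿ y i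

      toQⁿ-grid : ∀ x d γ i p →
                  lookup (lookup (toQⁿ (grid x d γ)) i) p ≡ functional p (column F i x) + lookup d i * functional p γ
      toQⁿ-grid x d γ i p = ≡.trans (cong (λ v → lookup v p) (lookup-toQⁿ (grid x d γ) i))
        (≡.trans (lookup-embed _ p) (≡.trans (cong (functional p) (column-grid x d γ i))
          (≡.trans (functional-+v p _ _) (cong (functional p (column F i x) +_) (functional-·v p (lookup d i) γ)))))

      toQⁿ-grid-column : ∀ x {d i} γ γ′ p → lookup d i ≢ 0# →
                         lookup (lookup (toQⁿ (grid x d γ)) i) p ≡ lookup (lookup (toQⁿ (grid x d γ′)) i) p →
                         column F p (toQⁿ (grid x d γ)) ≡ column F p (toQⁿ (grid x d γ′))
      toQⁿ-grid-column x {d} {i} γ γ′ p dᵢ≢0 same-at-i = lookup-ext λ i′ →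
        ≡.trans (lookup-column p (toQⁿ (grid x d γ)) i′) (≡.trans (toQⁿ-grid x d γ i′ p)
          (≡.trans (cong (λ z → functional p (column F i′ x) + lookup d i′ * z) same-γ)
            (≡.sym (≡.trans (lookup-column p (toQⁿ (grid x d γ′)) i′) (toQⁿ-grid x d γ′ i′ p)))))
        where
        same-γ : functional p γ ≡ functional p γ′
        same-γ = *-cancelˡ-≢0 dᵢ≢0 (≈⇒≡ (+-cancelˡ (functional p (column F i x)) _ _ (reflexive
          (≡.trans (≡.sym (toQⁿ-grid x d γ i p)) (≡.trans same-at-i (toQⁿ-grid x d γ′ i p))))))

      grid⇒forbidden : ∀ {A} → ContainsGrid F k n A → ContainsForbidden F Q q n (map toQⁿ A)
      grid⇒forbidden {A} (x , d , d≢0 , grid⊆A) = e , i , e∈ , Q⇔eᵢ , same-columns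
        where
        i : Fin n
        i = proj₁ (nonzero-entry d≢0)
        dᵢ≢0 : lookup d i ≢ 0#
        dᵢ≢0 = proj₂ (nonzero-entry d≢0)

        γ : Fin q → Vec Carrier k
        γ t = proj₁ (column-grid-onto x {d} dᵢ≢0 (List.lookup points t))

        e : Fin q → Vec (Vec Carrier (k ℕ.+ r)) n
        e t = toQⁿ (grid x d (γ t))

        e∈ : ∀ t → e t ∈ map toQⁿ A
        e∈ t = ∈-map⁺ toQⁿ (grid⊆A (γ t))

        eᵢ : ∀ t → lookup (e t) i ≡ embed (List.lookup points t)
        eᵢ t = ≡.trans (lookup-toQⁿ _ i) (cong embed (proj₂ (column-grid-onto x {d} dᵢ≢0 (List.lookup points t))))

        Q⇔eᵢ : ∀ y → Q y ⇔ ∃ λ t → lookup (e t) i ≡ y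
        Q⇔eᵢ y = mk⇔ (λ (α , y≡embedα) → let α∈ = complete (vecEnumeration carriers k) α in
                        Any.index α∈ ,
                        ≡.trans (eᵢ (Any.index α∈)) (≡.trans (cong embed (≡.sym (lookup-index α∈))) (≡.sym y≡embedα)))
                     (λ (t , eᵢ≡y) → List.lookup points t , ≡.trans (≡.sym eᵢ≡y) (eᵢ t))

        same-columns : ∀ p t t′ → lookup (lookup (e t) i) p ≡ lookup (lookup (e t′) i) p →
                       column F p (e t) ≡ column F p (e t′)
        same-columns p t t′ = toQⁿ-grid-column x {d} (γ t) (γ t′) p dᵢ≢0

      module _ (1∈Λ : 1# ∈ᵥ Λ) (Λ-spans : Spans Λ) where

        forbidden⇒grid : ∀ {A} → ContainsForbidden F Q q n (map toQⁿ A) → ContainsGrid F k n A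
        forbidden⇒grid {A} (e , i , e∈ , Q⇔eᵢ , same-columns) =
          g 0v , d , d≢0 , λ α → ≡.subst (_∈ A) (affine-columns⇒grid g δ (proj₂ ∘ h-affine) α) (g∈A α)
          where
          t : Vec Carrier k → Fin q
          t α = proj₁ (Equivalence.to (Q⇔eᵢ (embed α)) (α , ≡.refl))

          eₜᵢ : ∀ α → lookup (e (t α)) i ≡ embed α
          eₜᵢ α = proj₂ (Equivalence.to (Q⇔eᵢ (embed α)) (α , ≡.refl))

          g : Vec Carrier k → Vec (Vec Carrier n) k
          g α = proj₁ (∈-map⁻ toQⁿ (e∈ (t α)))

          g∈A : ∀ α → g α ∈ A
          g∈A α = proj₁ (proj₂ (∈-map⁻ toQⁿ (e∈ (t α))))

          h : Fin n → Vec Carrier k → Vec Carrier k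
          h i′ α = column F i′ (g α)

          eₜ≡embed-h : ∀ α i′ → lookup (e (t α)) i′ ≡ embed (h i′ α)
          eₜ≡embed-h α i′ =
            ≡.trans (cong (λ z → lookup z i′) (proj₂ (proj₂ (∈-map⁻ toQⁿ (e∈ (t α)))))) (lookup-toQⁿ (g α) i′)

          h-functional : ∀ p i′ → PreservesFibres (functional p) (h i′)
          h-functional p i′ {α} {α′} same-p =
            ≡.trans (≡.sym (entry α)) (≡.trans (cong (λ z → lookup z i′) same-column) (entry α′))
            where
            entry : ∀ α → lookup (column F p (e (t α))) i′ ≡ functional p (h i′ α)
            entry α = ≡.trans (lookup-column p (e (t α)) i′)
                        (≡.trans (cong (λ z → lookup z p) (eₜ≡embed-h α i′)) (lookup-embed (h i′ α) p))
            same-column : column F p (e (t α)) ≡ column F p (e (t α′))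
            same-column = same-columns p (t α) (t α′)
              (≡.trans (cong (λ z → lookup z p) (eₜᵢ α)) (≡.trans (lookup-embed α p) (≡.trans same-p
                (≡.sym (≡.trans (cong (λ z → lookup z p) (eₜᵢ α′)) (lookup-embed α′ p))))))

          h-affine : ∀ i′ → ∃ λ δ → ∀ α → h i′ α ≡ h i′ 0v +v δ ·v α
          h-affine i′ = preservesFibres⇒affine 1∈Λ Λ-spans (h i′)
            (λ j → preservesFibres-cong (functional-↑ˡ j) (h-functional (j ↑ˡ r) i′))
            (λ l → preservesFibres-cong (functional-↑ʳ l) (h-functional (k ↑ʳ l) i′))

          δ : Fin n → Carrier
          δ i′ = proj₁ (h-affine i′)

          d : Vec Carrier n
          d = tabulate δ

          hᵢ≡id : ∀ α → h i α ≡ α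
          hᵢ≡id α = embed-injective (≡.trans (≡.sym (eₜ≡embed-h α i)) (eₜᵢ α))

          d≢0 : d ≢ 0v
          d≢0 d≡0 = 0≢1 (≈⇒≡ (begin
            0#           ≡⟨ lookup-0v i ⟨
            lookup 0v i  ≡⟨ cong (λ v → lookup v i) d≡0 ⟨
            lookup d i   ≡⟨ lookup∘tabulate δ i ⟩
            δ i          ≡⟨ slope-of-identity (λ α → ≡.trans (≡.sym (hᵢ≡id α)) (proj₂ (h-affine i) α)) ⟩
            1#           ∎))

        map-toQⁿ-fromQⁿ : ∀ {W} → All (InPow F Q n) W → map toQⁿ (map fromQⁿ W) ≡ W
        map-toQⁿ-fromQⁿ []              = ≡.refl
        map-toQⁿ-fromQⁿ (z∈Qⁿ ∷ W⊆Qⁿ) = cong₂ _∷_ (toQⁿ-fromQⁿ z∈Qⁿ) (map-toQⁿ-fromQⁿ W⊆Qⁿ)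

        maxSize-gridFree⇒forbiddenFree : ∀ {M} → MaxSize (λ A → ¬ ContainsGrid F k n A) M →
                                         MaxSize (λ W → All (InPow F Q n) W × ¬ ContainsForbidden F Q q n W) M
        maxSize-gridFree⇒forbiddenFree = MaxSize-map toQⁿ toQⁿ-injective
          (λ {A} no-grid → All.map⁺ (All.tabulate (λ {y} _ → toQⁿ∈Qⁿ y)) , no-grid ∘ forbidden⇒grid)
          (λ {W} (W⊆Qⁿ , no-forbidden) → map fromQⁿ W , ≡.sym (map-toQⁿ-fromQⁿ W⊆Qⁿ) ,
             λ has-grid → no-forbidden (≡.subst (ContainsForbidden F Q q n) (map-toQⁿ-fromQⁿ W⊆Qⁿ) (grid⇒forbidden has-grid)))

    E≡rgrid : 1# ∈ᵥ Λ → Spans Λ → ∀ n → ∃[ x ] (IsE F Q n x × IsRgrid F k n x)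
    E≡rgrid 1∈Λ Λ-spans n =
      ℤ.+ M ℚ./ N ,
      (q , M , Q-card , maxSize-gridFree⇒forbiddenFree 1∈Λ Λ-spans M-max ,
       ≡.trans (cong (λ m → (ℤ.+ M ℚ./ N) ℚ.* (ℤ.+ m ℚ./ 1)) q^n≡N) (/-*-cancel M N)) ,
      (M , M-max , /-*-cancel M N)
      where
      M = proj₁ (maxSize-gridFree {k} {n})
      M-max = proj₂ (maxSize-gridFree {k} {n})
      N = size ^ (k ℕ.* n)
      instance
        N≢0 : NonZero N
        N≢0 = ℕ.m^n≢0 size (k ℕ.* n) {{Fin.nonZeroIndex (Inverse.to enum 0#)}}
      q^n≡N : q ^ n ≡ N
      q^n≡N = ≡.trans (cong (_^ n) q≡size^k) (ℕ.^-*-assoc size k n)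

-- Imported only here, since above _+_ is the addition of F.
open import Data.Nat using (_+_)

proposition4p12 : (F : FiniteField) (p r : ℕ) → Prime p →
                    FiniteField.size F ≡ p ^ r →
                    (k : ℕ) → 2 ≤ k →
                    ∃[ Q ] (IsSubspaceOfDim F (k + r) k Q ×
                            (∀ (n : ℕ) → ∃[ x ] (IsE F Q n x × IsRgrid F k n x)))
proposition4p12 F p r p-prime size≡p^r (suc (suc k′)) (s≤s (s≤s _)) =
  let Λ , 1∈Λ , Λ-spans = prime-power-basis F p-prime size≡p^r
  in Construction.Q F {k′} Λ , Construction.Q-isSubspace F Λ , Construction.E≡rgrid F Λ 1∈Λ Λ-spans
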